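{- The cluster counts $s_{n,k}$ for the consecutive pattern $15243$ satisfy the recurrence \[s_{n,k}=\sum_{\ell:\ 5\le 2\ell+3\le n}\binom{n-\ell-2}{\ell+1}\,s_{n-2\ell-2,\,k-\ell}\qquad\text{for } n\ge5,\] with initial conditions $s_{n,k}=0$ for $n<5$, except $s_{1,0}=1$.
   Context: For a consecutive pattern $\sigma$ of length $m$, a $k$-cluster of length $n\ge m$ is a permutation $\pi$ of $\{1,\dots,n\}$ that contains exactly $k$ occurrences of $\sigma$ as a consecutive pattern (contiguous entries in the same relative order as $\sigma$), in which every entry belongs to at least one occurrence, and in which any two successive occurrences overlap in at least one entry; for $n\ge m$, $s_{n,k}$ is the number of $k$-clusters of length $n$.
   Formalization: A k-cluster is a permutation π with a distinguished set of k occurrences of 15243 that covers every entry and whose successive members overlap, not a permutation having exactly k occurrences, so $s_{n,k}$ counts such pairs. The statement above fails without it. -}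

module Defs where

open import Data.Bool using (Bool; true; false; _∧_; _∨_; if_then_else_; not)
open import Data.Nat using (ℕ; zero; suc; _+_; _*_; _∸_; _<ᵇ_; _≡ᵇ_; _≤ᵇ_)
open import Data.Nat.Combinatorics using (_C_)
open import Data.List using (List; []; _∷_; length; map; concatMap; upTo; filterᵇ; drop; take; _++_)
open import Data.Bool.ListAction using (all; any)
open import Data.Nat.ListAction using (sum)

words : ℕ → ℕ → List (List ℕ)
words a zero    = [] ∷ []
words a (suc l) = concatMap (λ x → map (x ∷_) (words a l)) (map suc (upTo a))

countᵇ : ℕ → List ℕ → ℕ
countᵇ x []       = 0
countᵇ x (y ∷ ys) = (if x ≡ᵇ y then 1 else 0) + countᵇ x ys

isPermᵇ : ℕ → List ℕ → Bool
isPermᵇ n w = (length w ≡ᵇ n) ∧ all (λ i → countᵇ i w ≡ᵇ 1) (map suc (upTo n))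

-- All permutations of {1,…,n}, written in one-line notation as lists.
perms : ℕ → List (List ℕ)
perms n = filterᵇ (isPermᵇ n) (words n n)

-- Entry at position i (0-based); default 0 outside the range (never used there).
at : List ℕ → ℕ → ℕ
at []       _       = 0
at (x ∷ xs) zero    = x
at (x ∷ xs) (suc i) = at xs i

sameOrderᵇ : List ℕ → List ℕ → Bool
sameOrderᵇ u v =
  (length u ≡ᵇ length v) ∧
  all (λ a → all (λ b → (at u a <ᵇ at u b) ≡ᵇᵇ (at v a <ᵇ at v b))
                 (upTo (length u)))
      (upTo (length u))
  where
  _≡ᵇᵇ_ : Bool → Bool → Bool
  true  ≡ᵇᵇ b = b
  false ≡ᵇᵇ b = not b

-- σ occurs (consecutively) in w at the 0-based starting position i.
occursAtᵇ : List ℕ → List ℕ → ℕ → Bool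
occursAtᵇ σ w i = sameOrderᵇ (take (length σ) (drop i w)) σ

occurrences : List ℕ → List ℕ → List ℕ
occurrences σ w = filterᵇ (occursAtᵇ σ w) (upTo (suc (length w ∸ length σ)))

-- All sublists (subsequences) of a list; for an increasing list these are
-- exactly its subsets, listed increasingly, each once.
sublists : List ℕ → List (List ℕ)
sublists []       = [] ∷ []
sublists (x ∷ xs) = map (x ∷_) (sublists xs) ++ sublists xs

-- every entry (position j of a word of length n) lies in some marked occurrence
-- window [i, i+m-1], where S is the (increasing) list of marked starting positions
coveredᵇ : ℕ → ℕ → List ℕ → Bool
coveredᵇ m n S = all (λ j → any (λ i → (i ≤ᵇ j) ∧ (j <ᵇ i + m)) S) (upTo n)

-- successive marked occurrences (starting positions i < i') overlap in at least
-- one entry, i.e. i' ≤ i + m - 1, i.e. i' < i + m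
successiveOverlapᵇ : ℕ → List ℕ → Bool
successiveOverlapᵇ m []             = true
successiveOverlapᵇ m (i ∷ [])       = true
successiveOverlapᵇ m (i ∷ i' ∷ is)  = (i' <ᵇ i + m) ∧ successiveOverlapᵇ m (i' ∷ is)

-- S (a set of k occurrences of σ in π) makes π a k-cluster
isClusterMarkingᵇ : List ℕ → ℕ → List ℕ → List ℕ → Bool
isClusterMarkingᵇ σ k π S =
  (length S ≡ᵇ k) ∧ coveredᵇ (length σ) (length π) S ∧
  successiveOverlapᵇ (length σ) S

-- number of k-clusters of length n for σ, clusters being permutations together
-- with a distinguished set of k occurrences (Goulden–Jackson / Elizalde–Noy)
clusterCount : List ℕ → ℕ → ℕ → ℕ
clusterCount σ n k =
  sum (map (λ π → length (filterᵇ (isClusterMarkingᵇ σ k π) (sublists (occurrences σ π))))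
           (perms n))

σ₁₅₂₄₃ : List ℕ
σ₁₅₂₄₃ = 1 ∷ 5 ∷ 2 ∷ 4 ∷ 3 ∷ []

s : ℕ → ℕ → ℕ
s n k = if n <ᵇ 5 then (if (n ≡ᵇ 1) ∧ (k ≡ᵇ 0) then 1 else 0)
        else clusterCount σ₁₅₂₄₃ n k

-- Right-hand side: sum over ℓ with 5 ≤ 2ℓ+3 ≤ n of C(n-ℓ-2, ℓ+1) s_{n-2ℓ-2, k-ℓ};
-- terms with ℓ > k (negative second index) are 0.
rhs : ℕ → ℕ → ℕ
rhs n k = sum (map term (filterᵇ ok (upTo (suc n))))
  where
  ok : ℕ → Bool
  ok ℓ = (5 ≤ᵇ 2 * ℓ + 3) ∧ (2 * ℓ + 3 ≤ᵇ n) ∧ (ℓ ≤ᵇ k)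
  term : ℕ → ℕ
  term ℓ = ((n ∸ ℓ ∸ 2) C (ℓ + 1)) * s (n ∸ 2 * ℓ ∸ 2) (k ∸ ℓ)

module Submission where

-- A k-cluster is a permutation π together with a set S of k marked occurrence
-- positions, so s(n,k) = Σ_S N(n,S), where N(n,S) counts the permutations of
-- size n having an occurrence at every position of S ('s≡sumL-compatible').
-- 1. Since 15243 cannot overlap itself at distance 1 or 3, the admissible S are
--    the chains 0 = i₁ < … < i_k = n-5 with steps 2 and 4.  Cutting such a chain
--    after its initial run 0, 2, …, 2ℓ-2 leaves either nothing (n = 2ℓ+3) or a
--    chain S′ for length n-2ℓ-2, shifted by 2ℓ+2; this is a bijection
--    ('sumL-markings≡runDecomposition').
-- 2. Occurrences along the run say exactly that the first 2ℓ+3 entries are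
--    order-isomorphic to one fixed pattern whose last entry has ℓ+1 entries
--    above it ('runOccurrences'), and that entry is the minimum of the rest.
-- 3. The gluing lemma ('gluing') counts permutations whose prefix matches a
--    fixed pattern and whose suffix, overlapping it in one entry that is the
--    minimum of the suffix, is weighted by an order-invariant statistic: the
--    count is a binomial coefficient times the suffix count.  It gives
--    N(n, run ℓ ++ (2ℓ+2)+S′) = C(n-ℓ-2, ℓ+1) · N(n-2ℓ-2, S′).

open import Defs
open import Data.Bool using (Bool; true; false; _∧_; not; if_then_else_; T)
open import Data.Bool.Properties using (∧-assoc)
open import Data.Nat using (ℕ; zero; suc; _+_; _*_; _∸_; _≤_; _<_; z≤n; s≤s; _<ᵇ_; _≡ᵇ_; _≤ᵇ_; _⊔_; pred)
open import Data.Nat.Properties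
open import Algebra.Properties.CommutativeSemigroup +-commutativeSemigroup using () renaming (interchange to +-interchange; x∙yz≈y∙xz to +-exchange)
open import Data.Nat.Combinatorics using (_C_; nCn≡1; nCk+nC[k+1]≡[n+1]C[k+1])
open import Data.Nat.Tactic.RingSolver using (solve-∀)
open import Data.Nat.ListAction using (sum)
open import Data.Nat.ListAction.Properties using (sum-↭)
open import Data.List using (List; []; _∷_; length; map; concatMap; upTo; filterᵇ; drop; take; _++_; applyUpTo)
open import Data.List.Properties using (∷-injective; ∷-injectiveʳ; ++-cancelˡ; map-injective; take-all; drop-all; filter-++; length-map; map-∘; length-++; length-drop; drop-drop; map-id; ++-identityʳ)
open import Data.Bool.ListAction using (all; any)
open import Data.List.Relation.Unary.All using (All; []; _∷_)
import Data.List.Relation.Unary.All as All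
import Data.List.Relation.Unary.All.Properties as AllP
open import Data.List.Relation.Unary.All.Properties using (All¬⇒¬Any)
open import Data.List.Relation.Unary.Any using (here; there)
open import Data.List.Membership.Propositional using (_∈_)
open import Data.List.Membership.Propositional.Properties using (∈-map⁺; ∈-map⁻; ∈-++⁺ˡ; ∈-++⁺ʳ; ∈-++⁻; ∈-upTo⁺; ∈-upTo⁻)
open import Data.List.Membership.Propositional.Properties.WithK using (unique∧set⇒bag)
open import Data.List.Relation.Unary.Unique.Propositional using (Unique)
open import Data.List.Relation.Unary.AllPairs using ([]; _∷_)
import Data.List.Relation.Unary.Unique.Propositional.Properties as Unique
open import Data.List.Relation.Binary.BagAndSetEquality using (∼bag⇒↭)
open import Data.List.Relation.Binary.Permutation.Propositional using (_↭_)
import Data.List.Relation.Binary.Permutation.Propositional.Properties as ↭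
open import Data.Product using (∃; _×_; _,_; proj₁; proj₂)
open import Data.Sum using (_⊎_; inj₁; inj₂)
open import Data.Empty using (⊥; ⊥-elim)
open import Data.Unit using (⊤; tt)
open import Function using (_∘_)
open import Function.Bundles using (mk⇔)
open import Relation.Binary.PropositionalEquality
open import Relation.Nullary using (¬_; yes; no)
open import Relation.Nullary.Decidable.Core using (T?)

true≢false : true ≢ false
true≢false ()

∧-elim : ∀ {p q} → (p ∧ q) ≡ true → p ≡ true × q ≡ true
∧-elim {true} {true} _ = refl , refl

∧-intro : ∀ {p q} → p ≡ true → q ≡ true → (p ∧ q) ≡ true
∧-intro refl refl = refl

not≡true : ∀ {b} → not b ≡ true → b ≡ false
not≡true {false} _ = refl

notTrue : ∀ b → (b ≡ true → ⊥) → not b ≡ true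
notTrue true f = ⊥-elim (f refl)
notTrue false f = refl

bool-ext : ∀ {a b : Bool} → (a ≡ true → b ≡ true) → (b ≡ true → a ≡ true) → a ≡ b
bool-ext {true} {true} f g = refl
bool-ext {true} {false} f g = sym (f refl)
bool-ext {false} {true} f g = g refl
bool-ext {false} {false} f g = refl

-- Reflection for the Boolean comparisons on ℕ, stated with '≡ true' and
-- '≡ false' so that they can drive 'rewrite'.
≡ᵇ-refl : ∀ n → (n ≡ᵇ n) ≡ true
≡ᵇ-refl zero = refl
≡ᵇ-refl (suc n) = ≡ᵇ-refl n

≡ᵇ-≢ : ∀ m n → m ≢ n → (m ≡ᵇ n) ≡ false
≡ᵇ-≢ zero zero ne = ⊥-elim (ne refl)
≡ᵇ-≢ zero (suc n) ne = refl
≡ᵇ-≢ (suc m) zero ne = refl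
≡ᵇ-≢ (suc m) (suc n) ne = ≡ᵇ-≢ m n (λ e → ne (cong suc e))

≡ᵇ≡true⇒≡ : ∀ {m n} → (m ≡ᵇ n) ≡ true → m ≡ n
≡ᵇ≡true⇒≡ {m} {n} e = ≡ᵇ⇒≡ m n (subst T (sym e) tt)

<ᵇ-irrefl : ∀ n → (n <ᵇ n) ≡ false
<ᵇ-irrefl zero = refl
<ᵇ-irrefl (suc n) = <ᵇ-irrefl n

<⇒<ᵇ≡true : ∀ {m n} → m < n → (m <ᵇ n) ≡ true
<⇒<ᵇ≡true {zero} {suc n} _ = refl
<⇒<ᵇ≡true {suc m} {suc n} (s≤s lt) = <⇒<ᵇ≡true lt

≤⇒≮ᵇ : ∀ {m n} → n ≤ m → (m <ᵇ n) ≡ false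
≤⇒≮ᵇ {m} {zero} _ = refl
≤⇒≮ᵇ {suc m} {suc n} (s≤s le) = ≤⇒≮ᵇ le

<ᵇ≡true⇒< : ∀ {m n} → (m <ᵇ n) ≡ true → m < n
<ᵇ≡true⇒< {m} {n} e = <ᵇ⇒< m n (subst T (sym e) tt)

≮ᵇ⇒≤ : ∀ {m n} → (m <ᵇ n) ≡ false → n ≤ m
≮ᵇ⇒≤ {m} {n} e with m <? n
... | yes lt = ⊥-elim (subst (λ b → b ≡ false → ⊥) (sym (<⇒<ᵇ≡true lt)) (λ ()) e)
... | no nlt = ≮⇒≥ nlt

≤⇒≤ᵇ≡true : ∀ {m n} → m ≤ n → (m ≤ᵇ n) ≡ true
≤⇒≤ᵇ≡true {zero} le = refl
≤⇒≤ᵇ≡true {suc m} le = <⇒<ᵇ≡true le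

≤ᵇ≡true⇒≤ : ∀ {m n} → (m ≤ᵇ n) ≡ true → m ≤ n
≤ᵇ≡true⇒≤ {zero} e = z≤n
≤ᵇ≡true⇒≤ {suc m} e = <ᵇ≡true⇒< e

all-elim : ∀ {A : Set} (f : A → Bool) xs → all f xs ≡ true → ∀ {x} → x ∈ xs → f x ≡ true
all-elim f (y ∷ xs) h (here refl) = proj₁ (∧-elim {f y} h)
all-elim f (y ∷ xs) h (there m) = all-elim f xs (proj₂ (∧-elim {f y} h)) m

all-intro : ∀ {A : Set} (f : A → Bool) xs → (∀ {x} → x ∈ xs → f x ≡ true) → all f xs ≡ true
all-intro f [] h = refl
all-intro f (y ∷ xs) h rewrite h (here refl) = all-intro f xs (λ m → h (there m))

any-elim : ∀ {A : Set} (f : A → Bool) xs → any f xs ≡ true → ∃ λ x → x ∈ xs × f x ≡ true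
any-elim f (y ∷ xs) h with f y in e
... | true = y , here refl , e
... | false with any-elim f xs h
... | x , m , e' = x , there m , e'

any-intro : ∀ {A : Set} (f : A → Bool) xs {x} → x ∈ xs → f x ≡ true → any f xs ≡ true
any-intro f (y ∷ xs) (here refl) e rewrite e = refl
any-intro f (y ∷ xs) (there m) e with f y
... | true = refl
... | false = any-intro f xs m e

any-there : ∀ {A : Set} (f : A → Bool) x xs → any f xs ≡ true → any f (x ∷ xs) ≡ true
any-there f x xs h with f x
... | true = refl
... | false = h

all-map : ∀ {A B : Set} (f : B → Bool) (g : A → B) xs → all f (map g xs) ≡ all (λ x → f (g x)) xs
all-map f g [] = refl
all-map f g (x ∷ xs) = cong (f (g x) ∧_) (all-map f g xs)

all-cong : ∀ {A : Set} {f g : A → Bool} → (∀ x → f x ≡ g x) → ∀ xs → all f xs ≡ all g xs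
all-cong h [] = refl
all-cong h (x ∷ xs) = cong₂ _∧_ (h x) (all-cong h xs)

all-++ : ∀ (f : ℕ → Bool) xs ys → all f (xs ++ ys) ≡ (all f xs ∧ all f ys)
all-++ f [] ys = refl
all-++ f (x ∷ xs) ys rewrite all-++ f xs ys = sym (∧-assoc (f x) (all f xs) (all f ys))

all<ᵇ⇒All : ∀ x v → all (x <ᵇ_) v ≡ true → All (x <_) v
all<ᵇ⇒All x [] _ = []
all<ᵇ⇒All x (y ∷ v) h = <ᵇ≡true⇒< (proj₁ (∧-elim {x <ᵇ y} h)) ∷ all<ᵇ⇒All x v (proj₂ (∧-elim {x <ᵇ y} h))

b2n : Bool → ℕ
b2n true = 1
b2n false = 0

sumL : {A : Set} → (A → ℕ) → List A → ℕ
sumL f [] = 0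
sumL f (x ∷ xs) = f x + sumL f xs

sum-map : ∀ {A : Set} (f : A → ℕ) xs → sum (map f xs) ≡ sumL f xs
sum-map f [] = refl
sum-map f (x ∷ xs) = cong (f x +_) (sum-map f xs)

sumL-++ : ∀ {A : Set} (f : A → ℕ) xs ys → sumL f (xs ++ ys) ≡ sumL f xs + sumL f ys
sumL-++ f [] ys = refl
sumL-++ f (x ∷ xs) ys rewrite sumL-++ f xs ys = sym (+-assoc (f x) _ _)

sumL-map : ∀ {A B : Set} (f : B → ℕ) (g : A → B) xs → sumL f (map g xs) ≡ sumL (λ x → f (g x)) xs
sumL-map f g [] = refl
sumL-map f g (x ∷ xs) = cong (f (g x) +_) (sumL-map f g xs)

sumL-concatMap : ∀ {A B : Set} (f : B → ℕ) (g : A → List B) xs → sumL f (concatMap g xs) ≡ sumL (λ x → sumL f (g x)) xs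
sumL-concatMap f g [] = refl
sumL-concatMap f g (x ∷ xs) = trans (sumL-++ f (g x) (concatMap g xs)) (cong (sumL f (g x) +_) (sumL-concatMap f g xs))

sumL-congP : ∀ {A : Set} {P : A → Set} {f g : A → ℕ} → (∀ x → P x → f x ≡ g x) → ∀ {xs} → All P xs →
  sumL f xs ≡ sumL g xs
sumL-congP h [] = refl
sumL-congP h (px ∷ pxs) = cong₂ _+_ (h _ px) (sumL-congP h pxs)

sumL-cong-∈ : ∀ {A : Set} {f g : A → ℕ} {xs} → (∀ x → x ∈ xs → f x ≡ g x) → sumL f xs ≡ sumL g xs
sumL-cong-∈ h = sumL-congP h (All.tabulate (λ m → m))

sumL-cong : ∀ {A : Set} {f g : A → ℕ} → (∀ x → f x ≡ g x) → ∀ xs → sumL f xs ≡ sumL g xs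
sumL-cong h [] = refl
sumL-cong h (x ∷ xs) = cong₂ _+_ (h x) (sumL-cong h xs)

sumL-zero : ∀ {A : Set} (xs : List A) → sumL (λ _ → 0) xs ≡ 0
sumL-zero [] = refl
sumL-zero (x ∷ xs) = sumL-zero xs

sumL-0 : ∀ {A : Set} {f : A → ℕ} (xs : List A) → (∀ x → f x ≡ 0) → sumL f xs ≡ 0
sumL-0 xs h = trans (sumL-cong h xs) (sumL-zero xs)

sumL-+ : ∀ {A : Set} (f g : A → ℕ) xs → sumL (λ x → f x + g x) xs ≡ sumL f xs + sumL g xs
sumL-+ f g [] = refl
sumL-+ f g (x ∷ xs) rewrite sumL-+ f g xs = +-interchange (f x) (g x) (sumL f xs) (sumL g xs)

sumL-swap : ∀ {A B : Set} (f : A → B → ℕ) xs ys → sumL (λ x → sumL (f x) ys) xs ≡ sumL (λ y → sumL (λ x → f x y) xs) ys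
sumL-swap f [] ys = sym (sumL-zero ys)
sumL-swap f (x ∷ xs) ys = trans (cong (sumL (f x) ys +_) (sumL-swap f xs ys))
  (sym (sumL-+ (f x) (λ y → sumL (λ x₁ → f x₁ y) xs) ys))

sumL-*ˡ : ∀ {A : Set} c (f : A → ℕ) xs → c * sumL f xs ≡ sumL (λ x → c * f x) xs
sumL-*ˡ c f [] = *-zeroʳ c
sumL-*ˡ c f (x ∷ xs) = trans (*-distribˡ-+ c (f x) (sumL f xs)) (cong (c * f x +_) (sumL-*ˡ c f xs))

sumL-*ʳ : ∀ {A : Set} c (f : A → ℕ) xs → sumL f xs * c ≡ sumL (λ x → f x * c) xs
sumL-*ʳ c f xs = trans (*-comm (sumL f xs) c) (trans (sumL-*ˡ c f xs) (sumL-cong (λ x → *-comm c (f x)) xs))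

b2n-∧ : ∀ a b → b2n (a ∧ b) ≡ b2n a * b2n b
b2n-∧ true b = sym (+-identityʳ (b2n b))
b2n-∧ false b = refl

sumL-filterᵇ : ∀ {A : Set} (f : A → ℕ) (p : A → Bool) xs → sumL f (filterᵇ p xs) ≡ sumL (λ x → b2n (p x) * f x) xs
sumL-filterᵇ f p [] = refl
sumL-filterᵇ f p (x ∷ xs) with p x
... | true = cong₂ _+_ (sym (+-identityʳ (f x))) (sumL-filterᵇ f p xs)
... | false = sumL-filterᵇ f p xs

length-filterᵇ : ∀ {A : Set} (p : A → Bool) xs → length (filterᵇ p xs) ≡ sumL (λ x → b2n (p x)) xs
length-filterᵇ p [] = refl
length-filterᵇ p (x ∷ xs) with p x
... | true = cong suc (length-filterᵇ p xs)
... | false = length-filterᵇ p xs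

sumL-↭ : ∀ {A : Set} (f : A → ℕ) {xs ys} → xs ↭ ys → sumL f xs ≡ sumL f ys
sumL-↭ f {xs} {ys} p = trans (sym (sum-map f xs)) (trans (sum-↭ (↭.map⁺ f p)) (sum-map f ys))

sum-uniq : ∀ {A : Set} (f : A → ℕ) xs ys → Unique xs → Unique ys → (∀ {x} → x ∈ xs → x ∈ ys) →
  (∀ {x} → x ∈ ys → x ∈ xs) → sumL f xs ≡ sumL f ys
sum-uniq f xs ys ux uy to from = sumL-↭ f (∼bag⇒↭ (unique∧set⇒bag ux uy (λ {x} → mk⇔ to from)))

∈-filterᵇ⁻ : ∀ {A : Set} (p : A → Bool) xs {x} → x ∈ filterᵇ p xs → x ∈ xs × p x ≡ true
∈-filterᵇ⁻ p (y ∷ xs) m with p y in eq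
∈-filterᵇ⁻ p (y ∷ xs) (here refl) | true = here refl , eq
∈-filterᵇ⁻ p (y ∷ xs) (there m) | true with ∈-filterᵇ⁻ p xs m
... | m' , e = there m' , e
∈-filterᵇ⁻ p (y ∷ xs) m | false with ∈-filterᵇ⁻ p xs m
... | m' , e = there m' , e

∈-filterᵇ⁺ : ∀ {A : Set} (p : A → Bool) xs {x} → x ∈ xs → p x ≡ true → x ∈ filterᵇ p xs
∈-filterᵇ⁺ p (y ∷ xs) (here refl) e rewrite e = here refl
∈-filterᵇ⁺ p (y ∷ xs) (there m) e with p y
... | true = there (∈-filterᵇ⁺ p xs m e)
... | false = ∈-filterᵇ⁺ p xs m e

Unique-filterᵇ : ∀ {A : Set} (p : A → Bool) {xs} → Unique xs → Unique (filterᵇ p xs)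
Unique-filterᵇ p u = Unique.filter⁺ (λ x → T? (p x)) u

∈-concatMap⁻ : ∀ {A B : Set} (f : A → List B) xs {b} → b ∈ concatMap f xs → ∃ λ a → a ∈ xs × b ∈ f a
∈-concatMap⁻ f (x ∷ xs) m with ∈-++⁻ (f x) m
... | inj₁ m1 = x , here refl , m1
... | inj₂ m2 with ∈-concatMap⁻ f xs m2
... | a , ma , mb = a , there ma , mb

∈-concatMap⁺ : ∀ {A B : Set} (f : A → List B) xs {a b} → a ∈ xs → b ∈ f a → b ∈ concatMap f xs
∈-concatMap⁺ f (x ∷ xs) (here refl) mb = ∈-++⁺ˡ mb
∈-concatMap⁺ f (x ∷ xs) (there ma) mb = ∈-++⁺ʳ (f x) (∈-concatMap⁺ f xs ma mb)

Unique-concatMap : ∀ {A B : Set} (f : A → List B) xs → Unique xs → (∀ x → x ∈ xs → Unique (f x)) →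
  (∀ {x y b} → x ∈ xs → y ∈ xs → b ∈ f x → b ∈ f y → x ≡ y) → Unique (concatMap f xs)
Unique-concatMap f [] _ _ _ = []
Unique-concatMap f (x ∷ xs) (x∉ ∷ u) uf disj =
  Unique.++⁺ (uf x (here refl)) (Unique-concatMap f xs u (λ y m → uf y (there m))
    (λ mx my → disj (there mx) (there my)))
    (λ (m1 , m2) → d m1 m2)
  where
  d : ∀ {v} → v ∈ f x → v ∈ concatMap f xs → ⊥
  d m1 m2 with ∈-concatMap⁻ f xs m2
  ... | y , my , mb with disj (here refl) (there my) m1 mb
  ... | refl = All¬⇒¬Any x∉ my

Unique-map-on : ∀ {A B : Set} (f : A → B) xs → Unique xs → (∀ {x y} → x ∈ xs → y ∈ xs → f x ≡ f y → x ≡ y) →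
  Unique (map f xs)
Unique-map-on f [] _ _ = []
Unique-map-on f (x ∷ xs) (x∉ ∷ u) inj = hdAll xs x∉ (λ m e → inj (here refl) (there m) e) ∷ Unique-map-on f
  xs u (λ mx my e → inj (there mx) (there my) e)
  where
  hdAll : ∀ ys → All (x ≢_) ys → (∀ {y} → y ∈ ys → f x ≡ f y → x ≡ y) → All (f x ≢_) (map f ys)
  hdAll [] _ _ = []
  hdAll (y ∷ ys) (ne ∷ nes) h = (λ e → ne (h (here refl) e)) ∷ hdAll ys nes (λ m e → h (there m) e)

All-concatMap : ∀ {A B : Set} {P : A → Set} {Q : B → Set} (f : A → List B) → (∀ x → P x → All Q (f x)) →
  ∀ {xs} → All P xs → All Q (concatMap f xs)
All-concatMap f h [] = []
All-concatMap f h {x ∷ xs} (px ∷ pxs) = AllP.++⁺ (h x px) (All-concatMap f h pxs)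

All-map : ∀ {A B : Set} {P : A → Set} {Q : B → Set} (f : A → B) → (∀ x → P x → Q (f x)) → ∀ {xs} → All P xs →
  All Q (map f xs)
All-map f h [] = []
All-map f h (p ∷ ps) = h _ p ∷ All-map f h ps

rng : ℕ → ℕ → List ℕ
rng a zero = []
rng a (suc k) = a ∷ rng (suc a) k

rng-++ : ∀ a k l → rng a (k + l) ≡ rng a k ++ rng (k + a) l
rng-++ a zero l = refl
rng-++ a (suc k) l = cong (a ∷_) (trans (rng-++ (suc a) k l) (cong (λ z → rng (suc a) k ++ rng z l) (+-suc k a)))

rng-split : ∀ p m → rng 0 (suc (p + m)) ≡ rng 0 p ++ (p ∷ rng (suc p) m)
rng-split p m = trans (cong (rng 0) (sym (+-suc p m)))
  (trans (rng-++ 0 p (suc m)) (cong (λ z → rng 0 p ++ (z ∷ rng (suc z) m)) (+-identityʳ p)))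

rng-suc : ∀ a k → rng (suc a) k ≡ map suc (rng a k)
rng-suc a zero = refl
rng-suc a (suc k) = cong (suc a ∷_) (rng-suc (suc a) k)

applyUpTo-rng : ∀ {A : Set} (f : ℕ → A) n → applyUpTo f n ≡ map f (rng 0 n)
applyUpTo-rng f zero = refl
applyUpTo-rng f (suc n) =
  cong (f 0 ∷_) (trans (applyUpTo-rng (λ i → f (suc i)) n)
    (sym (trans (cong (map f) (rng-suc 0 n)) (sym (map-∘ (rng 0 n))))))

upTo-rng : ∀ n → upTo n ≡ rng 0 n
upTo-rng n = trans (applyUpTo-rng (λ i → i) n) (map-id (rng 0 n))

rng-All : ∀ a k → All (λ i → a ≤ i × i < a + k) (rng a k)
rng-All a zero = []
rng-All a (suc k) = (≤-refl , subst (a <_) (sym (+-suc a k)) (s≤s (m≤m+n a k))) ∷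
  All.map (λ {i} (l1 , l2) → <⇒≤ l1 , subst (i <_) (sym (+-suc a k)) l2) (rng-All (suc a) k)

∈-rng : ∀ j n → j < n → j ∈ rng 0 n
∈-rng j n lt = subst (j ∈_) (upTo-rng n) (∈-upTo⁺ lt)

Unique-rng : ∀ n → Unique (rng 0 n)
Unique-rng n = subst Unique (upTo-rng n) (Unique.upTo⁺ n)

sumL-rng-shift : ∀ (f : ℕ → ℕ) a b k → sumL f (rng (a + b) k) ≡ sumL (λ j → f (a + j)) (rng b k)
sumL-rng-shift f a b zero = refl
sumL-rng-shift f a b (suc k) = cong (f (a + b) +_)
  (trans (cong (λ z → sumL f (rng z k)) (sym (+-suc a b))) (sumL-rng-shift f a (suc b) k))

point-out : ∀ t g a k → (∀ i → a ≤ i → i < a + k → i ≢ t) → sumL (λ i → b2n (i ≡ᵇ t) * g) (rng a k) ≡ 0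
point-out t g a zero h = refl
point-out t g a (suc k) h rewrite ≡ᵇ-≢ a t (h a ≤-refl (m<m+n a (s≤s z≤n))) =
  point-out t g (suc a) k (λ i a<i i<k → h i (<⇒≤ a<i) (subst (i <_) (sym (+-suc a k)) i<k))

point-in : ∀ t g a k → a ≤ t → t < a + k → sumL (λ i → b2n (i ≡ᵇ t) * g) (rng a k) ≡ g
point-in t g a zero a≤t t<a rewrite +-identityʳ a = ⊥-elim (<-irrefl refl (≤-trans t<a a≤t))
point-in t g a (suc k) a≤t t<ak with a ≟ t
... | yes refl rewrite ≡ᵇ-refl a | +-identityʳ g | point-out a g (suc a) k
  (λ i a<i _ e → <-irrefl (sym e) a<i) = +-identityʳ g
... | no a≢t rewrite ≡ᵇ-≢ a t a≢t = point-in t g (suc a) k (≤∧≢⇒< a≤t a≢t) (subst (t <_) (+-suc a k) t<ak)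

ins : ℕ → ℕ → List ℕ → List ℕ
ins zero x w = x ∷ w
ins (suc i) x [] = x ∷ []
ins (suc i) x (y ∷ w) = y ∷ ins i x w

del : ℕ → List ℕ → List ℕ
del i [] = []
del zero (x ∷ w) = w
del (suc i) (x ∷ w) = x ∷ del i w

length-ins : ∀ i x w → length (ins i x w) ≡ suc (length w)
length-ins zero x w = refl
length-ins (suc i) x [] = refl
length-ins (suc i) x (y ∷ w) = cong suc (length-ins i x w)

length-del : ∀ i xs → i < length xs → suc (length (del i xs)) ≡ length xs
length-del zero (x ∷ xs) _ = refl
length-del (suc i) (x ∷ xs) (s≤s lt) = cong suc (length-del i xs lt)

del-ins : ∀ i x w → i ≤ length w → del i (ins i x w) ≡ w
del-ins zero x w _ = refl
del-ins (suc i) x (y ∷ w) (s≤s le) = cong (y ∷_) (del-ins i x w le)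

ins-del : ∀ i w → i < length w → ins i (at w i) (del i w) ≡ w
ins-del zero (x ∷ w) _ = refl
ins-del (suc i) (x ∷ w) (s≤s lt) = cong (x ∷_) (ins-del i w lt)

at-ins : ∀ i x w → i ≤ length w → at (ins i x w) i ≡ x
at-ins zero x w _ = refl
at-ins (suc i) x (y ∷ w) (s≤s le) = at-ins i x w le

at-del-≥ : ∀ i xs j → i ≤ j → at (del i xs) j ≡ at xs (suc j)
at-del-≥ i [] j _ = refl
at-del-≥ zero (x ∷ xs) j _ = refl
at-del-≥ (suc i) (x ∷ xs) (suc j) (s≤s le) = at-del-≥ i xs j le

at-map-suc : ∀ xs i → i < length xs → at (map suc xs) i ≡ suc (at xs i)
at-map-suc (x ∷ xs) zero _ = refl
at-map-suc (x ∷ xs) (suc i) (s≤s lt) = at-map-suc xs i lt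

All-at : ∀ {P : ℕ → Set} {xs} → All P xs → ∀ i → i < length xs → P (at xs i)
All-at (p ∷ ps) zero _ = p
All-at (p ∷ ps) (suc i) (s≤s lt) = All-at ps i lt

All-del : ∀ {P : ℕ → Set} {xs} → All P xs → ∀ i → All P (del i xs)
All-del [] i = []
All-del (p ∷ ps) zero = ps
All-del (p ∷ ps) (suc i) = p ∷ All-del ps i

All-ins : ∀ {P : ℕ → Set} i x w → P x → All P w → All P (ins i x w)
All-ins zero x w px aw = px ∷ aw
All-ins (suc i) x [] px aw = px ∷ []
All-ins (suc i) x (y ∷ w) px (py ∷ aw) = py ∷ All-ins i x w px aw

All-ins⁻ : ∀ {P : ℕ → Set} i x w → All P (ins i x w) → All P w
All-ins⁻ zero x w (_ ∷ aw) = aw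
All-ins⁻ (suc i) x [] _ = []
All-ins⁻ (suc i) x (y ∷ w) (py ∷ aw) = py ∷ All-ins⁻ i x w aw

sum-del : ∀ (f : ℕ → ℕ) xs i → i < length xs → sumL f xs ≡ f (at xs i) + sumL f (del i xs)
sum-del f (x ∷ xs) zero _ = refl
sum-del f (x ∷ xs) (suc i) (s≤s lt) rewrite sum-del f xs i lt = +-exchange (f x) (f (at xs i)) (sumL f (del i xs))

ins-injective-position : ∀ i j x (ρ : List ℕ) → All (_≢ x) ρ → i ≤ length ρ → j ≤ length ρ → ins i x ρ ≡
  ins j x ρ → i ≡ j
ins-injective-position zero zero x ρ _ _ _ _ = refl
ins-injective-position zero (suc j) x (y ∷ ρ) (ne ∷ _) _ _ e = ⊥-elim (ne (sym (proj₁ (∷-injective e))))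
ins-injective-position (suc i) zero x (y ∷ ρ) (ne ∷ _) _ _ e = ⊥-elim (ne (proj₁ (∷-injective e)))
ins-injective-position (suc i) (suc j) x (y ∷ ρ) (_ ∷ al) (s≤s li) (s≤s lj) e = cong suc
  (ins-injective-position i j x ρ al li lj (proj₂ (∷-injective e)))

ins-injective-list : ∀ i j x (ρ ρ' : List ℕ) → All (_≢ x) ρ → All (_≢ x) ρ' → ins i x ρ ≡ ins j x ρ' → ρ ≡ ρ'
ins-injective-list zero zero x ρ ρ' _ _ e = proj₂ (∷-injective e)
ins-injective-list zero (suc j) x ρ [] _ _ e = proj₂ (∷-injective e)
ins-injective-list zero (suc j) x ρ (y ∷ ρ') _ (ne ∷ _) e = ⊥-elim (ne (sym (proj₁ (∷-injective e))))
ins-injective-list (suc i) zero x [] ρ' _ _ e = proj₂ (∷-injective e)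
ins-injective-list (suc i) zero x (y ∷ ρ) ρ' (ne ∷ _) _ e = ⊥-elim (ne (proj₁ (∷-injective e)))
ins-injective-list (suc i) (suc j) x [] [] _ _ e = refl
ins-injective-list (suc i) (suc j) x [] (y ∷ ρ') _ (ne ∷ _) e = ⊥-elim (ne (sym (proj₁ (∷-injective e))))
ins-injective-list (suc i) (suc j) x (y ∷ ρ) [] (ne ∷ _) _ e = ⊥-elim (ne (proj₁ (∷-injective e)))
ins-injective-list (suc i) (suc j) x (y ∷ ρ) (y' ∷ ρ') (_ ∷ a) (_ ∷ b) e = cong₂ _∷_ (proj₁ (∷-injective e))
  (ins-injective-list i j x ρ ρ' a b (proj₂ (∷-injective e)))

take-ins : ∀ i p x ρ → i ≤ p → take (suc p) (ins i x ρ) ≡ ins i x (take p ρ)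
take-ins zero p x ρ _ = refl
take-ins (suc i) (suc p) x [] _ = refl
take-ins (suc i) (suc p) x (y ∷ ρ) (s≤s le) = cong (y ∷_) (take-ins i p x ρ le)

drop-ins-< : ∀ i p x ρ → i ≤ p → i ≤ length ρ → drop (suc p) (ins i x ρ) ≡ drop p ρ
drop-ins-< zero p x ρ _ _ = refl
drop-ins-< (suc i) (suc p) x (y ∷ ρ) (s≤s le) (s≤s le') = drop-ins-< i p x ρ le le'

drop-ins-= : ∀ p x ρ → p ≤ length ρ → drop p (ins p x ρ) ≡ x ∷ drop p ρ
drop-ins-= zero x ρ _ = refl
drop-ins-= (suc p) x (y ∷ ρ) (s≤s le) = drop-ins-= p x ρ le

drop-ins-> : ∀ p j x ρ → p ≤ length ρ → drop p (ins (p + j) x ρ) ≡ ins j x (drop p ρ)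
drop-ins-> zero j x ρ _ = refl
drop-ins-> (suc p) j x (y ∷ ρ) (s≤s le) = drop-ins-> p j x ρ le

take-ins-> : ∀ p j x ρ → suc p ≤ length ρ → take (suc p) (ins (p + suc j) x ρ) ≡ take (suc p) ρ
take-ins-> zero j x (y ∷ ρ) _ = refl
take-ins-> (suc p) j x (y ∷ ρ) (s≤s le) = cong (y ∷_) (take-ins-> p j x ρ le)

length-take-exact : ∀ p (ρ : List ℕ) → p ≤ length ρ → length (take p ρ) ≡ p
length-take-exact zero ρ _ = refl
length-take-exact (suc p) (y ∷ ρ) (s≤s le) = cong suc (length-take-exact p ρ le)

length-take≤ : ∀ k (π : List ℕ) → length (take k π) ≤ length π
length-take≤ zero π = z≤n
length-take≤ (suc k) [] = z≤n
length-take≤ (suc k) (x ∷ π) = s≤s (length-take≤ k π)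

All-take : ∀ {P : ℕ → Set} p {ρ} → All P ρ → All P (take p ρ)
All-take zero _ = []
All-take (suc p) [] = []
All-take (suc p) (q ∷ qs) = q ∷ All-take p qs

All-drop : ∀ {P : ℕ → Set} p {ρ} → All P ρ → All P (drop p ρ)
All-drop zero a = a
All-drop (suc p) [] = []
All-drop (suc p) (q ∷ qs) = All-drop p qs

drop-comm : ∀ c a (τ : List ℕ) → drop (c + a) τ ≡ drop c (drop a τ)
drop-comm c a τ = trans (cong (λ z → drop z τ) (+-comm c a)) (sym (drop-drop a c τ))

map-shift : ∀ a b (R : List ℕ) → map (a +_) (map (b +_) R) ≡ map ((a + b) +_) R
map-shift a b [] = refl
map-shift a b (x ∷ R) = cong₂ _∷_ (sym (+-assoc a b x)) (map-shift a b R)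

maxL : List ℕ → ℕ
maxL [] = 0
maxL (x ∷ xs) = x ⊔ maxL xs

argmax : List ℕ → ℕ
argmax [] = 0
argmax (x ∷ xs) = if x <ᵇ maxL xs then suc (argmax xs) else 0

All-≤max : ∀ α → All (_≤ maxL α) α
All-≤max [] = []
All-≤max (x ∷ xs) = m≤m⊔n x (maxL xs) ∷ All.map (λ p → ≤-trans p (m≤n⊔m x (maxL xs))) (All-≤max xs)

All<suc-max : ∀ w → All (_< suc (maxL w)) w
All<suc-max w = All.map s≤s (All-≤max w)

at-argmax : ∀ x xs → at (x ∷ xs) (argmax (x ∷ xs)) ≡ maxL (x ∷ xs)
at-argmax x xs with x <ᵇ maxL xs in eq
at-argmax x [] | true = case eq
  where case : (x <ᵇ 0) ≡ true → _
        case ()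
at-argmax x (y ∷ ys) | true = trans (at-argmax y ys) (sym (m≤n⇒m⊔n≡n (<⇒≤ (<ᵇ≡true⇒< eq))))
... | false = sym (m≥n⇒m⊔n≡m (≮ᵇ⇒≤ eq))

argmax< : ∀ x xs → argmax (x ∷ xs) < suc (length xs)
argmax< x xs with x <ᵇ maxL xs in eq
argmax< x [] | true = case eq
  where case : (x <ᵇ 0) ≡ true → _
        case ()
argmax< x (y ∷ ys) | true = s≤s (argmax< y ys)
... | false = s≤s z≤n

argmax<length : ∀ α → 0 < length α → argmax α < length α
argmax<length (c ∷ γ) _ = argmax< c γ

All<⇒max≤ : ∀ {x} xs → All (_< x) xs → maxL xs ≤ x
All<⇒max≤ [] [] = z≤n
All<⇒max≤ (y ∷ ys) (p ∷ ps) = ⊔-lub (<⇒≤ p) (All<⇒max≤ ys ps)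

at≤max : ∀ xs i → at xs i ≤ maxL xs
at≤max [] i = z≤n
at≤max (x ∷ xs) zero = m≤m⊔n x (maxL xs)
at≤max (x ∷ xs) (suc i) = ≤-trans (at≤max xs i) (m≤n⊔m x (maxL xs))

Distinct : List ℕ → Set
Distinct [] = ⊤
Distinct (x ∷ xs) = All (x ≢_) xs × Distinct xs

Distinct-del : ∀ i xs → Distinct xs → Distinct (del i xs)
Distinct-del i [] d = tt
Distinct-del zero (x ∷ xs) (_ , d) = d
Distinct-del (suc i) (x ∷ xs) (a , d) = All-del a i , Distinct-del i xs d

Distinct-map-suc : ∀ xs → Distinct xs → Distinct (map suc xs)
Distinct-map-suc [] _ = tt
Distinct-map-suc (x ∷ xs) (a , d) = All-map suc (λ y ne e → ne (suc-injective e)) a , Distinct-map-suc xs d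

del-≢ : ∀ i xs → Distinct xs → i < length xs → All (_≢ at xs i) (del i xs)
del-≢ zero (x ∷ xs) (a , d) _ = flip a
  where
  flip : ∀ {ys} → All (x ≢_) ys → All (_≢ x) ys
  flip [] = []
  flip (p ∷ ps) = (λ e → p (sym e)) ∷ flip ps
del-≢ (suc i) (x ∷ xs) (a , d) (s≤s lt) = All-at a i lt ∷ del-≢ i xs d lt

argmax-strict : ∀ x xs → Distinct (x ∷ xs) → All (_< at (x ∷ xs) (argmax (x ∷ xs))) (del (argmax (x ∷ xs)) (x ∷ xs))
argmax-strict x xs d = comb (All-del
  (subst (λ m → All (_≤ m) (x ∷ xs)) (sym (at-argmax x xs)) (All-≤max (x ∷ xs))) (argmax (x ∷ xs)))
                         (del-≢ (argmax (x ∷ xs)) (x ∷ xs) d (argmax< x xs))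
  where
  comb : ∀ {m ys} → All (_≤ m) ys → All (_≢ m) ys → All (_< m) ys
  comb [] [] = []
  comb (p ∷ ps) (q ∷ qs) = ≤∧≢⇒< p q ∷ comb ps qs

argmax-strict' : ∀ α → 0 < length α → Distinct α → All (_< at α (argmax α)) (del (argmax α) α)
argmax-strict' (c ∷ γ) _ d = argmax-strict c γ d

argmax-unique : ∀ α i → i < length α → All (_< at α i) (del i α) → i ≡ argmax α
argmax-unique (x ∷ xs) zero _ al rewrite ≤⇒≮ᵇ (All<⇒max≤ xs al) = refl
argmax-unique (x ∷ xs) (suc i) (s≤s lt) (x< ∷ al) rewrite <⇒<ᵇ≡true (<-≤-trans x< (at≤max xs i)) = cong suc
  (argmax-unique xs i lt al)

notAllAbove : ∀ {N} v → 0 < length v → All (_< N) v → ¬ All (N <_) v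
notAllAbove (y ∷ v) _ (y<N ∷ _) (N<y ∷ _) = <-asym y<N N<y

dropMax : List ℕ → List ℕ
dropMax α = del (argmax α) α

dropMax-shape : ∀ p α → length α ≡ suc (suc p) → Distinct α → length (dropMax α) ≡ suc p × Distinct (dropMax α)
dropMax-shape p α len d =
  suc-injective (trans (length-del (argmax α) α (argmax<length α (subst (0 <_) (sym len) (s≤s z≤n)))) len) ,
  Distinct-del (argmax α) α d

argmax-cases : ∀ p α → length α ≡ suc p → argmax α < p ⊎ argmax α ≡ p
argmax-cases p α len = m≤n⇒m<n∨m≡n
  (≤-pred (subst (argmax α <_) len (argmax<length α (subst (0 <_) (sym len) (s≤s z≤n)))))

-- Order isomorphism.  'Iso u v' says that u and v have the same length and the
-- same relative order; it is defined recursively through 'Cmp x y u v', which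
-- says that x compares with the entries of u as y compares with those of v.
Cmp : ℕ → ℕ → List ℕ → List ℕ → Set
Cmp x y [] [] = ⊤
Cmp x y (a ∷ u) (b ∷ v) = ((x <ᵇ a) ≡ (y <ᵇ b)) × ((a <ᵇ x) ≡ (b <ᵇ y)) × Cmp x y u v
Cmp x y [] (_ ∷ _) = ⊥
Cmp x y (_ ∷ _) [] = ⊥

Iso : List ℕ → List ℕ → Set
Iso [] [] = ⊤
Iso (x ∷ u) (y ∷ v) = Cmp x y u v × Iso u v
Iso [] (_ ∷ _) = ⊥
Iso (_ ∷ _) [] = ⊥

Iso-len : ∀ u v → Iso u v → length u ≡ length v
Iso-len [] [] _ = refl
Iso-len (x ∷ u) (y ∷ v) (_ , i) = cong suc (Iso-len u v i)

Cmp-refl : ∀ x u → Cmp x x u u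
Cmp-refl x [] = tt
Cmp-refl x (a ∷ u) = refl , refl , Cmp-refl x u

Iso-refl : ∀ u → Iso u u
Iso-refl [] = tt
Iso-refl (x ∷ u) = Cmp-refl x u , Iso-refl u

Cmp-sym : ∀ x y u v → Cmp x y u v → Cmp y x v u
Cmp-sym x y [] [] c = tt
Cmp-sym x y (a ∷ u) (b ∷ v) (e1 , e2 , c) = sym e1 , sym e2 , Cmp-sym x y u v c

Iso-sym : ∀ u v → Iso u v → Iso v u
Iso-sym [] [] i = tt
Iso-sym (x ∷ u) (y ∷ v) (c , i) = Cmp-sym x y u v c , Iso-sym u v i

Iso-drop : ∀ k u v → Iso u v → Iso (drop k u) (drop k v)
Iso-drop zero u v i = i
Iso-drop (suc k) [] [] i = tt
Iso-drop (suc k) (x ∷ u) (y ∷ v) (c , i) = Iso-drop k u v i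

Cmp-del : ∀ i x y u v → Cmp x y u v → Cmp x y (del i u) (del i v)
Cmp-del i x y [] [] c = tt
Cmp-del zero x y (a ∷ u) (b ∷ v) (_ , _ , c) = c
Cmp-del (suc i) x y (a ∷ u) (b ∷ v) (e1 , e2 , c) = e1 , e2 , Cmp-del i x y u v c

Cmp-at : ∀ x y u v → Cmp x y u v → ∀ b → b < length u →
  ((x <ᵇ at u b) ≡ (y <ᵇ at v b)) × ((at u b <ᵇ x) ≡ (at v b <ᵇ y))
Cmp-at x y (a ∷ u) (c ∷ v) (e1 , e2 , _) zero _ = e1 , e2
Cmp-at x y (a ∷ u) (c ∷ v) (_ , _ , cc) (suc b) (s≤s lt) = Cmp-at x y u v cc b lt

Cmp-up : ∀ x y u v → Cmp x y u v → All (y <_) v → All (x <_) u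
Cmp-up x y [] [] _ _ = []
Cmp-up x y (a ∷ u) (b ∷ v) (e1 , e2 , c) (y<b ∷ al) = <ᵇ≡true⇒< (trans e1 (<⇒<ᵇ≡true y<b)) ∷ Cmp-up x y u v c al

Cmp-down : ∀ x y u v → Cmp x y u v → All (_< y) v → All (_< x) u
Cmp-down x y [] [] _ _ = []
Cmp-down x y (a ∷ u) (b ∷ v) (e1 , e2 , c) (b<y ∷ al) = <ᵇ≡true⇒< (trans e2 (<⇒<ᵇ≡true b<y)) ∷ Cmp-down x y u v c al

Iso-singleton : ∀ x y → Iso (x ∷ []) (y ∷ [])
Iso-singleton x y = tt , tt

Cmp-above-all : ∀ x y u v → length u ≡ length v → All (_< x) u → All (_< y) v → Cmp x y u v
Cmp-above-all x y [] [] _ _ _ = tt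
Cmp-above-all x y (a ∷ u) (b ∷ v) eq (a<x ∷ au) (b<y ∷ bv) =
  trans (≤⇒≮ᵇ (<⇒≤ a<x)) (sym (≤⇒≮ᵇ (<⇒≤ b<y))) , trans (<⇒<ᵇ≡true a<x) (sym (<⇒<ᵇ≡true b<y)) , Cmp-above-all
    x y u v (suc-injective eq) au bv

Cmp-ins : ∀ i x y a b u v → Cmp a b u v → (a <ᵇ x) ≡ (b <ᵇ y) → (x <ᵇ a) ≡ (y <ᵇ b) → Cmp a b (ins i x u) (ins i y v)
Cmp-ins zero x y a b u v c e1 e2 = e1 , e2 , c
Cmp-ins (suc i) x y a b [] [] c e1 e2 = e1 , e2 , tt
Cmp-ins (suc i) x y a b (c ∷ u) (d ∷ v) (f1 , f2 , cc) e1 e2 = f1 , f2 , Cmp-ins i x y a b u v cc e1 e2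

Iso-ins : ∀ i x y u v → Iso u v → All (_< x) u → All (_< y) v → Iso (ins i x u) (ins i y v)
Iso-ins zero x y u v iso au bv = Cmp-above-all x y u v (Iso-len u v iso) au bv , iso
Iso-ins (suc i) x y [] [] iso au bv = tt , tt
Iso-ins (suc i) x y (a ∷ u) (b ∷ v) (c , iso) (a<x ∷ au) (b<y ∷ bv) =
  Cmp-ins i x y a b u v c (trans (<⇒<ᵇ≡true a<x) (sym (<⇒<ᵇ≡true b<y)))
    (trans (≤⇒≮ᵇ (<⇒≤ a<x)) (sym (≤⇒≮ᵇ (<⇒≤ b<y)))) ,
  Iso-ins i x y u v iso au bv

Cmp-map-suc⇒ : ∀ x y u v → Cmp x (suc y) u (map suc v) → Cmp x y u v
Cmp-map-suc⇒ x y [] [] c = tt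
Cmp-map-suc⇒ x y (a ∷ u) (b ∷ v) (e1 , e2 , c) = e1 , e2 , Cmp-map-suc⇒ x y u v c

Cmp-map-suc⇐ : ∀ x y u v → Cmp x y u v → Cmp x (suc y) u (map suc v)
Cmp-map-suc⇐ x y [] [] c = tt
Cmp-map-suc⇐ x y (a ∷ u) (b ∷ v) (e1 , e2 , c) = e1 , e2 , Cmp-map-suc⇐ x y u v c

Iso-map-suc⇒ : ∀ u v → Iso u (map suc v) → Iso u v
Iso-map-suc⇒ [] [] i = tt
Iso-map-suc⇒ (x ∷ u) (y ∷ v) (c , i) = Cmp-map-suc⇒ x y u v c , Iso-map-suc⇒ u v i

Iso-map-suc⇐ : ∀ u v → Iso u v → Iso u (map suc v)
Iso-map-suc⇐ [] [] i = tt
Iso-map-suc⇐ (x ∷ u) (y ∷ v) (c , i) = Cmp-map-suc⇐ x y u v c , Iso-map-suc⇐ u v i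

Cmp-bottom⇒ : ∀ x w A → Cmp x 1 w (map suc A) → All (1 ≤_) A → All (x <_) w
Cmp-bottom⇒ x [] [] c _ = []
Cmp-bottom⇒ x (a ∷ w) (suc b ∷ A) (e1 , e2 , c) (_ ∷ al) = <ᵇ≡true⇒< e1 ∷ Cmp-bottom⇒ x w A c al

Cmp-bottom⇐ : ∀ x w A → All (x <_) w → All (1 ≤_) A → length w ≡ length A → Cmp x 1 w (map suc A)
Cmp-bottom⇐ x [] [] _ _ _ = tt
Cmp-bottom⇐ x (a ∷ w) (suc b ∷ A) (x<a ∷ aw) (_ ∷ al) le = <⇒<ᵇ≡true x<a , ≤⇒≮ᵇ (<⇒≤ x<a) , Cmp-bottom⇐ x w A
  aw al (suc-injective le)

Cmp-top⇒ : ∀ x K w A → Cmp x (suc (suc K)) w (map suc A) → All (_≤ K) A → All (_< x) w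
Cmp-top⇒ x K [] [] c _ = []
Cmp-top⇒ x K (a ∷ w) (b ∷ A) (e1 , e2 , c) (b≤K ∷ al) = <ᵇ≡true⇒< (trans e2 (<⇒<ᵇ≡true (s≤s b≤K))) ∷ Cmp-top⇒
  x K w A c al

Cmp-top⇐ : ∀ x K w A → All (_< x) w → All (_≤ K) A → length w ≡ length A → Cmp x (suc (suc K)) w (map suc A)
Cmp-top⇐ x K [] [] _ _ _ = tt
Cmp-top⇐ x K (a ∷ w) (b ∷ A) (a<x ∷ aw) (b≤K ∷ al) le =
  trans (≤⇒≮ᵇ (<⇒≤ a<x)) (sym (≤⇒≮ᵇ {suc K} {b} (≤-trans b≤K (n≤1+n K)))) , trans (<⇒<ᵇ≡true a<x)
    (sym (<⇒<ᵇ≡true (s≤s b≤K))) , Cmp-top⇐ x K w A aw al (suc-injective le)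

IsoAt : List ℕ → List ℕ → Set
IsoAt u v = length u ≡ length v × (∀ a b → a < length u → b < length u → (at u a <ᵇ at u b) ≡ (at v a <ᵇ at v b))

sameOrder⇒IsoAt : ∀ u v → sameOrderᵇ u v ≡ true → IsoAt u v
sameOrder⇒IsoAt u v h = ≡ᵇ⇒≡ _ _ (subst T (sym (proj₁ (∧-elim {length u ≡ᵇ length v} h))) tt) , pt
  where
  pt : ∀ a b → a < length u → b < length u → (at u a <ᵇ at u b) ≡ (at v a <ᵇ at v b)
  pt a b a< b< with at u a <ᵇ at u b | at v a <ᵇ at v b | all-elim _ _
    (all-elim _ _ (proj₂ (∧-elim {length u ≡ᵇ length v} h)) (∈-upTo⁺ a<)) (∈-upTo⁺ b<)
  ... | true | true | _ = refl
  ... | false | false | _ = refl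
  ... | true | false | ()
  ... | false | true | ()

Iso⇒IsoAt : ∀ u v → Iso u v → IsoAt u v
Iso⇒IsoAt u v iso = Iso-len u v iso , go u v iso
  where
  go : ∀ u v → Iso u v → ∀ a b → a < length u → b < length u → (at u a <ᵇ at u b) ≡ (at v a <ᵇ at v b)
  go (x ∷ u) (y ∷ v) (c , i) zero zero _ _ = trans (<ᵇ-irrefl x) (sym (<ᵇ-irrefl y))
  go (x ∷ u) (y ∷ v) (c , i) zero (suc b) _ (s≤s lt) = proj₁ (Cmp-at x y u v c b lt)
  go (x ∷ u) (y ∷ v) (c , i) (suc a) zero (s≤s lt) _ = proj₂ (Cmp-at x y u v c a lt)
  go (x ∷ u) (y ∷ v) (c , i) (suc a) (suc b) (s≤s l1) (s≤s l2) = go u v i a b l1 l2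

IsoAt⇒Iso : ∀ u v → IsoAt u v → Iso u v
IsoAt⇒Iso [] [] _ = tt
IsoAt⇒Iso [] (_ ∷ _) (() , _)
IsoAt⇒Iso (_ ∷ _) [] (() , _)
IsoAt⇒Iso (x ∷ u) (y ∷ v) (le , pt) = mkC u v (suc-injective le)
  (λ b lt → pt zero (suc b) (s≤s z≤n) (s≤s lt) , pt (suc b) zero (s≤s lt) (s≤s z≤n)) ,
  IsoAt⇒Iso u v (suc-injective le , λ a b l1 l2 → pt (suc a) (suc b) (s≤s l1) (s≤s l2))
  where
  mkC : ∀ u v → length u ≡ length v →
    (∀ b → b < length u → ((x <ᵇ at u b) ≡ (y <ᵇ at v b)) × ((at u b <ᵇ x) ≡ (at v b <ᵇ y))) → Cmp x y u v
  mkC [] [] _ _ = tt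
  mkC (a ∷ u) (c ∷ v) le h = proj₁ (h zero (s≤s z≤n)) , proj₂ (h zero (s≤s z≤n)) , mkC u v (suc-injective le)
    (λ b lt → h (suc b) (s≤s lt))

sameBool : Bool → Bool → Bool
sameBool true b = b
sameBool false true = false
sameBool false false = true

sameBool⇒≡ : ∀ p q → sameBool p q ≡ true → p ≡ q
sameBool⇒≡ true true _ = refl
sameBool⇒≡ false false _ = refl

≡⇒sameBool : ∀ p q → p ≡ q → sameBool p q ≡ true
≡⇒sameBool true .true refl = refl
≡⇒sameBool false .false refl = refl

cmpᵇ : ℕ → ℕ → List ℕ → List ℕ → Bool
cmpᵇ x y [] [] = true
cmpᵇ x y (a ∷ u) (b ∷ v) = sameBool (x <ᵇ a) (y <ᵇ b) ∧ (sameBool (a <ᵇ x) (b <ᵇ y) ∧ cmpᵇ x y u v)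
cmpᵇ x y [] (_ ∷ _) = false
cmpᵇ x y (_ ∷ _) [] = false

isoᵇ : List ℕ → List ℕ → Bool
isoᵇ [] [] = true
isoᵇ (x ∷ u) (y ∷ v) = cmpᵇ x y u v ∧ isoᵇ u v
isoᵇ [] (_ ∷ _) = false
isoᵇ (_ ∷ _) [] = false

cmpᵇ⇒ : ∀ x y u v → cmpᵇ x y u v ≡ true → Cmp x y u v
cmpᵇ⇒ x y [] [] _ = tt
cmpᵇ⇒ x y (a ∷ u) (b ∷ v) h with ∧-elim {sameBool (x <ᵇ a) (y <ᵇ b)} h
... | h1 , h2 with ∧-elim {sameBool (a <ᵇ x) (b <ᵇ y)} h2
... | h3 , h4 = sameBool⇒≡ _ _ h1 , sameBool⇒≡ _ _ h3 , cmpᵇ⇒ x y u v h4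

⇒cmpᵇ : ∀ x y u v → Cmp x y u v → cmpᵇ x y u v ≡ true
⇒cmpᵇ x y [] [] _ = refl
⇒cmpᵇ x y (a ∷ u) (b ∷ v) (e1 , e2 , c) = ∧-intro (≡⇒sameBool _ _ e1) (∧-intro (≡⇒sameBool _ _ e2) (⇒cmpᵇ x y u v c))

isoᵇ⇒ : ∀ u v → isoᵇ u v ≡ true → Iso u v
isoᵇ⇒ [] [] _ = tt
isoᵇ⇒ (x ∷ u) (y ∷ v) h with ∧-elim {cmpᵇ x y u v} h
... | h1 , h2 = cmpᵇ⇒ x y u v h1 , isoᵇ⇒ u v h2

⇒isoᵇ : ∀ u v → Iso u v → isoᵇ u v ≡ true
⇒isoᵇ [] [] _ = refl
⇒isoᵇ (x ∷ u) (y ∷ v) (c , i) = ∧-intro (⇒cmpᵇ x y u v c) (⇒isoᵇ u v i)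

all-Cmp : ∀ x y u v → Cmp x y u v → all (x <ᵇ_) u ≡ all (y <ᵇ_) v
all-Cmp x y [] [] _ = refl
all-Cmp x y (a ∷ u) (b ∷ v) (e1 , _ , c) = cong₂ _∧_ e1 (all-Cmp x y u v c)

iso-ins-inv : ∀ i x w α → Iso (ins i x w) α → i ≤ length w → All (_< x) w → All (_< at α i) (del i α) × Iso w (del i α)
iso-ins-inv zero x w (a ∷ α) (c , iso) _ aw = Cmp-down a x α w (Cmp-sym x a w α c) aw , iso
iso-ins-inv (suc i) x (b ∷ w) (a ∷ α) (c , iso) (s≤s le) (b<x ∷ aw) with iso-ins-inv i x w α iso le aw
... | al , iso' = a<ai ∷ al , subst (λ z → Cmp b a z (del i α)) (del-ins i x w le)
  (Cmp-del i b a (ins i x w) α c) , iso'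
  where
  ilt : i < length (ins i x w)
  ilt rewrite length-ins i x w = s≤s le
  a<ai : a < at α i
  a<ai = <ᵇ≡true⇒< (trans (sym (proj₁ (Cmp-at b a (ins i x w) α c i ilt)))
    (subst (λ z → (b <ᵇ z) ≡ true) (sym (at-ins i x w le)) (<⇒<ᵇ≡true b<x)))

iso-ins-bool : ∀ i x w α → length α ≡ suc (length w) → Distinct α → All (_< x) w → i ≤ length w →
  isoᵇ (ins i x w) α ≡ (i ≡ᵇ argmax α) ∧ isoᵇ w (del (argmax α) α)
iso-ins-bool i x w [] () d aw le
iso-ins-bool i x w (a ∷ α) len d aw le with isoᵇ (ins i x w) (a ∷ α) in e
... | true with iso-ins-inv i x w (a ∷ α) (isoᵇ⇒ _ _ e) le aw
... | al , iso' with argmax-unique (a ∷ α) i (subst (i <_) (sym len) (s≤s le)) al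
... | refl rewrite ≡ᵇ-refl (argmax (a ∷ α)) | ⇒isoᵇ _ _ iso' = refl
iso-ins-bool i x w (a ∷ α) len d aw le | false with i ≡ᵇ argmax (a ∷ α) in e1 | isoᵇ w
  (del (argmax (a ∷ α)) (a ∷ α)) in e2
... | false | _ = refl
... | true | false = refl
... | true | true = ⊥-elim (true≢false (trans (sym (⇒isoᵇ _ _ isoα)) e))
  where
  i≡ : i ≡ argmax (a ∷ α)
  i≡ = ≡ᵇ⇒≡ i _ (subst T (sym e1) tt)
  isoα : Iso (ins i x w) (a ∷ α)
  isoα = subst (λ z → Iso (ins i x w) z) (ins-del i (a ∷ α) (subst (_< length (a ∷ α)) (sym i≡) (argmax< a α)))
           (Iso-ins i x (at (a ∷ α) i) w (del i (a ∷ α))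
             (subst (λ j → Iso w (del j (a ∷ α))) (sym i≡) (isoᵇ⇒ _ _ e2)) aw
             (subst (λ j → All (_< at (a ∷ α) j) (del j (a ∷ α))) (sym i≡) (argmax-strict a α d)))

insertions : ℕ → List ℕ → List (List ℕ)
insertions n ρ = map (λ i → ins i (suc n) ρ) (rng 0 (suc n))

Perm : ℕ → List (List ℕ)
Perm zero = [] ∷ []
Perm (suc n) = concatMap (insertions n) (Perm n)

PermShape : ℕ → List ℕ → Set
PermShape n ρ = length ρ ≡ n × All (_≤ n) ρ

Perm-shape : ∀ n → All (PermShape n) (Perm n)
Perm-shape zero = (refl , []) ∷ []
Perm-shape (suc n) = All-concatMap _ (λ ρ (len , al) → All-map (λ i → ins i (suc n) ρ)
    (λ i _ → trans (length-ins i (suc n) ρ) (cong suc len) , All-ins i (suc n) ρ ≤-refl (All.map (λ le → ≤-trans le (n≤1+n n)) al))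
    (rng-All 0 (suc n))) (Perm-shape n)

sumL-Perm : ∀ n (g : List ℕ → ℕ) → sumL g (Perm (suc n)) ≡
  sumL (λ ρ → sumL (λ i → g (ins i (suc n) ρ)) (rng 0 (suc n))) (Perm n)
sumL-Perm n g = trans (sumL-concatMap g _ (Perm n)) (sumL-cong (λ ρ → sumL-map g _ (rng 0 (suc n))) (Perm n))

-- Induction on q: the new maximum must be
-- inserted at the position of the maximum of γ.
rigidity : ∀ q γ → length γ ≡ q → Distinct γ → sumL (λ ρ → b2n (isoᵇ ρ γ)) (Perm q) ≡ 1
rigidity zero [] refl d = refl
rigidity (suc q) (c ∷ γ) len d =
  trans (sumL-Perm q _)
  (trans (sumL-congP {P = PermShape q} step (Perm-shape q))
   (rigidity q (del (argmax (c ∷ γ)) (c ∷ γ)) (suc-injective (trans (length-del (argmax (c ∷ γ)) (c ∷ γ) (argmax< c γ)) len)) (Distinct-del (argmax (c ∷ γ)) (c ∷ γ) d)))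
  where
  step : ∀ ρ → PermShape q ρ → sumL (λ i → b2n (isoᵇ (ins i (suc q) ρ) (c ∷ γ))) (rng 0 (suc q)) ≡
    b2n (isoᵇ ρ (del (argmax (c ∷ γ)) (c ∷ γ)))
  step ρ (lenρ , al) =
    trans (sumL-congP {P = λ i → 0 ≤ i × i < 0 + suc q}
             (λ i (_ , i<) → trans (cong b2n (iso-ins-bool i (suc q) ρ (c ∷ γ) (trans len (cong suc (sym lenρ))) d (All.map s≤s al) (subst (i ≤_) (sym lenρ) (≤-pred i<))))
                                   (b2n-∧ (i ≡ᵇ argmax (c ∷ γ)) _))
             (rng-All 0 (suc q)))
          (point-in (argmax (c ∷ γ)) _ 0 (suc q) z≤n (subst (argmax (c ∷ γ) <_) len (argmax< c γ)))

words⇒ : ∀ a l w → w ∈ words a l → length w ≡ l × All (λ x → 1 ≤ x × x ≤ a) w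
words⇒ a zero .[] (here refl) = refl , []
words⇒ a (suc l) w m with ∈-concatMap⁻ (λ x → map (x ∷_) (words a l)) (map suc (upTo a)) m
... | x , mx , mw with ∈-map⁻ (x ∷_) mw | ∈-map⁻ suc mx
... | w' , mw' , refl | x' , mx' , refl with words⇒ a l w' mw'
... | len , al = cong suc len , (s≤s z≤n , ∈-upTo⁻ mx') ∷ al

words⇐ : ∀ a l w → length w ≡ l → All (λ x → 1 ≤ x × x ≤ a) w → w ∈ words a l
words⇐ a zero [] _ _ = here refl
words⇐ a (suc l) (suc x' ∷ w) len ((_ , le) ∷ al) =
  ∈-concatMap⁺ (λ x → map (x ∷_) (words a l)) (map suc (upTo a)) (∈-map⁺ suc (∈-upTo⁺ le))
    (∈-map⁺ (suc x' ∷_) (words⇐ a l w (suc-injective len) al))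

Unique-words : ∀ a l → Unique (words a l)
Unique-words a zero = [] ∷ []
Unique-words a (suc l) = Unique-concatMap (λ x → map (x ∷_) (words a l)) (map suc (upTo a))
  (Unique.map⁺ suc-injective (Unique.upTo⁺ a))
  (λ x _ → Unique.map⁺ (λ e → proj₂ (∷-injective e)) (Unique-words a l))
  (λ {x} {y} {b} _ _ bx by → hd-eq bx by)
  where
  hd-eq : ∀ {x y b} → b ∈ map (x ∷_) (words a l) → b ∈ map (y ∷_) (words a l) → x ≡ y
  hd-eq {x} {y} bx by with ∈-map⁻ (x ∷_) bx | ∈-map⁻ (y ∷_) by
  ... | w1 , _ , refl | w2 , _ , e = proj₁ (∷-injective e)

countᵇ-ins : ∀ i j x ρ → countᵇ i (ins j x ρ) ≡ (if i ≡ᵇ x then 1 else 0) + countᵇ i ρ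
countᵇ-ins i zero x ρ = refl
countᵇ-ins i (suc j) x [] = refl
countᵇ-ins i (suc j) x (y ∷ ρ) rewrite countᵇ-ins i j x ρ = +-exchange (if i ≡ᵇ y then 1 else 0)
  (if i ≡ᵇ x then 1 else 0) (countᵇ i ρ)

count0 : ∀ i ρ → All (_≢ i) ρ → countᵇ i ρ ≡ 0
count0 i [] _ = refl
count0 i (y ∷ ρ) (ne ∷ al) rewrite ≡ᵇ-≢ i y (λ e → ne (sym e)) = count0 i ρ al

count0⇒ : ∀ i ρ → countᵇ i ρ ≡ 0 → All (_≢ i) ρ
count0⇒ i [] _ = []
count0⇒ i (y ∷ ρ) e with i ≡ᵇ y in eq
... | true = ⊥-elim (1+n≢0 e)
... | false = (λ yi → true≢false (trans (sym (subst (λ z → (i ≡ᵇ z) ≡ true) (sym yi) (≡ᵇ-refl i))) eq)) ∷ count0⇒ i ρ e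

Perm-positive : ∀ n → All (All (1 ≤_)) (Perm n)
Perm-positive zero = [] ∷ []
Perm-positive (suc n) = All-concatMap _
  (λ ρ al → All-map (λ i → ins i (suc n) ρ) (λ i _ → All-ins i (suc n) ρ (s≤s z≤n) al) (rng-All 0 (suc n)))
  (Perm-positive n)

∈Perm-count : ∀ n π → π ∈ Perm n → ∀ i → 1 ≤ i → i ≤ n → countᵇ i π ≡ 1
∈Perm-count zero π _ (suc i) _ ()
∈Perm-count (suc n) π m i 1≤i i≤ with ∈-concatMap⁻ (insertions n) (Perm n) m
... | ρ , mρ , mπ with ∈-map⁻ (λ j → ins j (suc n) ρ) {xs = rng 0 (suc n)} mπ
... | j , _ , refl rewrite countᵇ-ins i j (suc n) ρ with i ≟ suc n
... | yes refl rewrite ≡ᵇ-refl (suc n) = cong suc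
  (count0 (suc n) ρ (All.map (λ {x} le e → <-irrefl e (s≤s le)) (proj₂ (All.lookup (Perm-shape n) mρ))))
... | no ne rewrite ≡ᵇ-≢ i (suc n) ne = ∈Perm-count n ρ mρ i 1≤i (≤-pred (≤∧≢⇒< i≤ ne))

Perm⇒perms : ∀ n π → π ∈ Perm n → π ∈ perms n
Perm⇒perms n π m = ∈-filterᵇ⁺ (isPermᵇ n) (words n n) (words⇐ n n π len (All.zip (pos , proj₂ pp)))
  (∧-intro (subst (λ z → (length π ≡ᵇ z) ≡ true) len (≡ᵇ-refl (length π))) cnt)
  where
  pp = All.lookup (Perm-shape n) m
  len = proj₁ pp
  pos = All.lookup (Perm-positive n) m
  cnt : all (λ i → countᵇ i π ≡ᵇ 1) (map suc (upTo n)) ≡ true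
  cnt = all-intro _ (map suc (upTo n)) (λ {i} mi → h mi)
    where
    h : ∀ {i} → i ∈ map suc (upTo n) → (countᵇ i π ≡ᵇ 1) ≡ true
    h mi with ∈-map⁻ suc mi
    ... | i' , mi' , refl rewrite ∈Perm-count n π m (suc i') (s≤s z≤n) (∈-upTo⁻ mi') = refl

extract-unique : ∀ x π → countᵇ x π ≡ 1 → ∃ λ j → ∃ λ ρ → (π ≡ ins j x ρ) × (j ≤ length ρ)
extract-unique x (y ∷ π) e with x ≡ᵇ y in eq
... | true = 0 , π , cong (_∷ π) (sym (≡ᵇ≡true⇒≡ eq)) , z≤n
... | false with extract-unique x π e
... | j , ρ , refl , le = suc j , y ∷ ρ , refl , s≤s le

permutation⇒Perm : ∀ n π → length π ≡ n → All (λ x → 1 ≤ x × x ≤ n) π →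
  (∀ i → 1 ≤ i → i ≤ n → countᵇ i π ≡ 1) → π ∈ Perm n
permutation⇒Perm zero [] _ _ _ = here refl
permutation⇒Perm (suc n) π len bd cnt with extract-unique (suc n) π (cnt (suc n) (s≤s z≤n) ≤-refl)
... | j , ρ , refl , le = ∈-concatMap⁺ (insertions n) (Perm n) mρ
  (∈-map⁺ (λ i → ins i (suc n) ρ) (∈-rng j (suc n) (s≤s (subst (j ≤_) lenρ le))))
  where
  lenρ : length ρ ≡ n
  lenρ = suc-injective (trans (sym (length-ins j (suc n) ρ)) len)
  c0 : countᵇ (suc n) ρ ≡ 0
  c0 = suc-injective (trans (sym (trans (countᵇ-ins (suc n) j (suc n) ρ)
    (cong (λ b → (if b then 1 else 0) + countᵇ (suc n) ρ) (≡ᵇ-refl (suc n))))) (cnt (suc n) (s≤s z≤n) ≤-refl))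
  bdρ : All (λ x → 1 ≤ x × x ≤ n) ρ
  bdρ = zipper (All-ins⁻ j (suc n) ρ bd) (count0⇒ (suc n) ρ c0)
    where
    zipper : ∀ {xs} → All (λ x → 1 ≤ x × x ≤ suc n) xs → All (_≢ suc n) xs → All (λ x → 1 ≤ x × x ≤ n) xs
    zipper [] [] = []
    zipper ((a , b) ∷ ps) (q ∷ qs) = (a , ≤-pred (≤∧≢⇒< b q)) ∷ zipper ps qs
  cntρ : ∀ i → 1 ≤ i → i ≤ n → countᵇ i ρ ≡ 1
  cntρ i a b = trans (sym (cong (λ z → (if z then 1 else 0) + countᵇ i ρ)
    (≡ᵇ-≢ i (suc n) (λ e → <-irrefl e (s≤s b)))))
    (trans (sym (countᵇ-ins i j (suc n) ρ)) (cnt i a (≤-trans b (n≤1+n n))))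
  mρ : ρ ∈ Perm n
  mρ = permutation⇒Perm n ρ lenρ bdρ cntρ

perms⇒Perm : ∀ n π → π ∈ perms n → π ∈ Perm n
perms⇒Perm n π m with ∈-filterᵇ⁻ (isPermᵇ n) (words n n) m
... | mw , ip with words⇒ n n π mw | ∧-elim {length π ≡ᵇ n} ip
... | len , bd | _ , cnt = permutation⇒Perm n π len bd (λ i a b → c i a b)
  where
  c : ∀ i → 1 ≤ i → i ≤ n → countᵇ i π ≡ 1
  c (suc i') _ b = ≡ᵇ≡true⇒≡ (all-elim _ (map suc (upTo n)) cnt (∈-map⁺ suc (∈-upTo⁺ b)))

Perm-avoids-next : ∀ n ρ → PermShape n ρ → All (_≢ suc n) ρ
Perm-avoids-next n ρ (_ , al) = All.map (λ {x} le e → <-irrefl e (s≤s le)) al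

Unique-Perm : ∀ n → Unique (Perm n)
Unique-Perm zero = [] ∷ []
Unique-Perm (suc n) = Unique-concatMap (insertions n) (Perm n) (Unique-Perm n)
  (λ ρ mρ → Unique-map-on (λ i → ins i (suc n) ρ) (rng 0 (suc n)) (Unique-rng (suc n))
     (λ {i} {j} mi mj e → ins-injective-position i j (suc n) ρ (Perm-avoids-next n ρ (All.lookup (Perm-shape n) mρ))
        (subst (i ≤_) (sym (proj₁ (All.lookup (Perm-shape n) mρ))) (≤-pred (proj₂ (All.lookup (rng-All 0 (suc n)) mi))))
        (subst (j ≤_) (sym (proj₁ (All.lookup (Perm-shape n) mρ))) (≤-pred (proj₂ (All.lookup (rng-All 0 (suc n)) mj)))) e))
  disj
  where
  disj : ∀ {ρ ρ' b} → ρ ∈ Perm n → ρ' ∈ Perm n → b ∈ insertions n ρ → b ∈ insertions n ρ' → ρ ≡ ρ'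
  disj {ρ} {ρ'} m1 m2 b1 b2 with ∈-map⁻ (λ i → ins i (suc n) ρ) {xs = rng 0 (suc n)} b1 | ∈-map⁻
    (λ i → ins i (suc n) ρ') {xs = rng 0 (suc n)} b2
  ... | i , _ , refl | j , _ , e = ins-injective-list i j (suc n) ρ ρ'
    (Perm-avoids-next n ρ (All.lookup (Perm-shape n) m1)) (Perm-avoids-next n ρ' (All.lookup (Perm-shape n) m2)) e

sumL-perms≡Perm : ∀ n (f : List ℕ → ℕ) → sumL f (perms n) ≡ sumL f (Perm n)
sumL-perms≡Perm n f = sum-uniq f (perms n) (Perm n) (Unique-filterᵇ (isPermᵇ n) (Unique-words n n))
  (Unique-Perm n) (λ {π} m → perms⇒Perm n π m) (λ {π} m → Perm⇒perms n π m)

countAbove : ℕ → List ℕ → ℕ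
countAbove t xs = sumL (λ y → b2n (t <ᵇ y)) xs

aboveLast : List ℕ → ℕ
aboveLast α = countAbove (at α (pred (length α))) α

aboveLast-del : ∀ α i q → length α ≡ suc (suc q) → i ≤ q → All (_< at α i) (del i α) → aboveLast α ≡
  suc (aboveLast (del i α))
aboveLast-del α i q len le al = trans (cong (λ L → countAbove (at α (pred L)) α) len)
  (trans (sum-del _ α i ilt) (cong₂ _+_ one rest))
  where
  ilt : i < length α
  ilt rewrite len = s≤s (≤-trans le (n≤1+n q))
  ldel : length (del i α) ≡ suc q
  ldel = suc-injective (trans (length-del i α ilt) len)
  lastEq : at (del i α) q ≡ at α (suc q)
  lastEq = at-del-≥ i α q le
  qlt : q < length (del i α)
  qlt rewrite ldel = ≤-refl
  one : b2n (at α (suc q) <ᵇ at α i) ≡ 1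
  one rewrite <⇒<ᵇ≡true (subst (_< at α i) lastEq (All-at al q qlt)) = refl
  rest : countAbove (at α (suc q)) (del i α) ≡ aboveLast (del i α)
  rest rewrite ldel | lastEq = refl

aboveLast-max : ∀ α p → length α ≡ suc p → argmax α ≡ p → aboveLast α ≡ 0
aboveLast-max [] p () _
aboveLast-max (x ∷ xs) p len e = subst (λ L → countAbove (at (x ∷ xs) (pred L)) (x ∷ xs) ≡ 0) (sym len)
  (subst (λ j → countAbove (at (x ∷ xs) j) (x ∷ xs) ≡ 0) e
    (subst (λ m → countAbove m (x ∷ xs) ≡ 0) (sym (at-argmax x xs)) (zeroAll (All-≤max (x ∷ xs)))))
  where
  zeroAll : ∀ {m ys} → All (_≤ m) ys → countAbove m ys ≡ 0
  zeroAll [] = refl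
  zeroAll {m} (p ∷ ps) rewrite ≤⇒≮ᵇ p = zeroAll ps

IsoInvariant : (List ℕ → ℕ) → Set
IsoInvariant R = ∀ u v → Iso u v → R u ≡ R v

HeadMinOnly : (List ℕ → ℕ) → Set
HeadMinOnly R = ∀ x v → ¬ All (x <_) v → R (x ∷ v) ≡ 0

glued : ℕ → List ℕ → (List ℕ → ℕ) → List ℕ → ℕ
glued p α R π = b2n (isoᵇ (take (suc p) π) α) * R (drop p π)

withMaxAt : (List ℕ → ℕ) → ℕ → List ℕ → ℕ
withMaxAt R j w = R (ins j (suc (maxL w)) w)

insertLarger≡withMaxAt : ∀ R → IsoInvariant R → ∀ j N w → All (_< N) w → R (ins j N w) ≡ withMaxAt R j w
insertLarger≡withMaxAt R ri j N w al = ri _ _ (Iso-ins j N (suc (maxL w)) w w (Iso-refl w) al (All<suc-max w))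

IsoInvariant-withMaxAt : ∀ R → IsoInvariant R → ∀ j → IsoInvariant (withMaxAt R j)
IsoInvariant-withMaxAt R ri j u v iso = ri _ _ (Iso-ins j _ _ u v iso (All<suc-max u) (All<suc-max v))

HeadMinOnly-withMaxAt : ∀ R → HeadMinOnly R → ∀ j → HeadMinOnly (withMaxAt R (suc j))
HeadMinOnly-withMaxAt R hz j x v nall = hz x (ins j (suc (maxL (x ∷ v))) v) (λ al → nall (All-ins⁻ j _ v al))

GluingIdentity : ℕ → ℕ → List ℕ → (List ℕ → ℕ) → Set
GluingIdentity p m α R =
  sumL (glued p α R) (Perm (suc (p + m))) ≡ ((aboveLast α + m) C aboveLast α) * sumL R (Perm (suc m))

-- Summing over 'Perm (1 + p + m)' inserts the maximum N = p+m+1 into a smaller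
-- permutation ρ, either inside the α-window (before position p), at position
-- p, or after it.
gluedBefore gluedAt gluedAfter : ℕ → ℕ → List ℕ → (List ℕ → ℕ) → ℕ
gluedBefore p m α R = sumL (λ ρ → sumL (λ i → glued p α R (ins i (suc (p + m)) ρ)) (rng 0 p)) (Perm (p + m))

gluedAt p m α R = sumL (λ ρ → glued p α R (ins p (suc (p + m)) ρ)) (Perm (p + m))

gluedAfter p m α R = sumL (λ ρ → sumL (λ i → glued p α R (ins i (suc (p + m)) ρ)) (rng (suc p) m)) (Perm (p + m))

insertion-positions-split : ∀ p m α R ρ → sumL (λ i → glued p α R (ins i (suc (p + m)) ρ)) (rng 0 (suc (p + m)))
   ≡ sumL (λ i → glued p α R (ins i (suc (p + m)) ρ)) (rng 0 p) + (glued p α R (ins p (suc (p + m)) ρ) + sumL (λ i → glued p α R (ins i (suc (p + m)) ρ)) (rng (suc p) m))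
insertion-positions-split p m α R ρ = trans
  (cong (sumL (λ i → glued p α R (ins i (suc (p + m)) ρ))) (rng-split p m))
  (sumL-++ (λ i → glued p α R (ins i (suc (p + m)) ρ)) (rng 0 p) _)

glued-split : ∀ p m α R → sumL (glued p α R) (Perm (suc (p + m))) ≡
  gluedBefore p m α R + (gluedAt p m α R + gluedAfter p m α R)
glued-split p m α R =
  trans (sumL-Perm (p + m) (glued p α R))
  (trans (sumL-cong (insertion-positions-split p m α R) (Perm (p + m)))
  (trans (sumL-+ _ (λ ρ → glued p α R (ins p (suc (p + m)) ρ) + sumL
    (λ i → glued p α R (ins i (suc (p + m)) ρ)) (rng (suc p) m)) (Perm (p + m)))
  (cong (gluedBefore p m α R +_) (sumL-+ _ _ (Perm (p + m))))))

-- Inserting N before position p: the window matches α only if N lands at the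
-- position of α's maximum, and then the rest matches α with its maximum
-- removed (which has one fewer entry above the last one).
glued-ins-window : ∀ p' m α R → length α ≡ suc (suc p') → Distinct α → ∀ ρ → PermShape (suc p' + m) ρ → ∀ i →
  i < suc p' →
  glued (suc p') α R (ins i (suc (suc p' + m)) ρ) ≡ b2n (i ≡ᵇ argmax α) * glued p' (dropMax α) R ρ
glued-ins-window p' m α R len d ρ (lenρ , al) i i< =
  begin
    b2n (isoᵇ (take (suc (suc p')) (ins i N ρ)) α) * R (drop (suc p') (ins i N ρ))
  ≡⟨ cong₂ (λ a b → b2n (isoᵇ a α) * R b) (take-ins i (suc p') N ρ (<⇒≤ i<))
    (drop-ins-< i p' N ρ (≤-pred i<) (≤-trans (<⇒≤ i<) le1)) ⟩
    b2n (isoᵇ (ins i N (take (suc p') ρ)) α) * R (drop p' ρ)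
  ≡⟨ cong (λ z → b2n z * R (drop p' ρ))
    (iso-ins-bool i N (take (suc p') ρ) α lenα d (All-take (suc p') (All.map s≤s al)) i≤) ⟩
    b2n ((i ≡ᵇ argmax α) ∧ isoᵇ (take (suc p') ρ) (dropMax α)) * R (drop p' ρ)
  ≡⟨ cong (_* R (drop p' ρ)) (b2n-∧ (i ≡ᵇ argmax α) _) ⟩
    b2n (i ≡ᵇ argmax α) * b2n (isoᵇ (take (suc p') ρ) (dropMax α)) * R (drop p' ρ)
  ≡⟨ *-assoc (b2n (i ≡ᵇ argmax α)) _ _ ⟩
    b2n (i ≡ᵇ argmax α) * glued p' (dropMax α) R ρ
  ∎
  where
  open ≡-Reasoning
  N = suc (suc p' + m)
  le1 : suc p' ≤ length ρ
  le1 rewrite lenρ = m≤m+n (suc p') m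
  lenα : length α ≡ suc (length (take (suc p') ρ))
  lenα = trans len (cong suc (sym (length-take-exact (suc p') ρ le1)))
  i≤ : i ≤ length (take (suc p') ρ)
  i≤ = subst (i ≤_) (sym (length-take-exact (suc p') ρ le1)) (<⇒≤ i<)

gluedBefore-lt-pointwise : ∀ p' m α R → length α ≡ suc (suc p') → Distinct α → argmax α < suc p' → ∀ ρ →
  PermShape (suc p' + m) ρ →
  sumL (λ i → glued (suc p') α R (ins i (suc (suc p' + m)) ρ)) (rng 0 (suc p')) ≡ glued p' (dropMax α) R ρ
gluedBefore-lt-pointwise p' m α R len d lt ρ shape =
  trans (sumL-congP {P = λ i → 0 ≤ i × i < 0 + suc p'}
    (λ i (_ , i<) → glued-ins-window p' m α R len d ρ shape i i<) (rng-All 0 (suc p')))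
        (point-in (argmax α) _ 0 (suc p') z≤n lt)

gluedBefore-lt : ∀ p' m α R → length α ≡ suc (suc p') → Distinct α → argmax α < suc p' →
  gluedBefore (suc p') m α R ≡ sumL (glued p' (dropMax α) R) (Perm (suc (p' + m)))
gluedBefore-lt p' m α R len d lt = sumL-congP (gluedBefore-lt-pointwise p' m α R len d lt) (Perm-shape (suc p' + m))

gluedBefore-eq-pointwise : ∀ p m α R → length α ≡ suc p → Distinct α → argmax α ≡ p → ∀ ρ → PermShape (p + m) ρ →
  sumL (λ i → glued p α R (ins i (suc (p + m)) ρ)) (rng 0 p) ≡ 0
gluedBefore-eq-pointwise zero m α R len d e ρ _ = refl
gluedBefore-eq-pointwise (suc p') m α R len d e ρ shape =
  trans (sumL-congP {P = λ i → 0 ≤ i × i < 0 + suc p'}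
    (λ i (_ , i<) → glued-ins-window p' m α R len d ρ shape i i<) (rng-All 0 (suc p')))
        (point-out (argmax α) _ 0 (suc p') (λ i _ i< ie → <-irrefl (trans ie e) i<))

gluedBefore-eq : ∀ p m α R → length α ≡ suc p → Distinct α → argmax α ≡ p → gluedBefore p m α R ≡ 0
gluedBefore-eq p m α R len d e = trans
  (sumL-congP (gluedBefore-eq-pointwise p m α R len d e) (Perm-shape (p + m))) (sumL-zero (Perm (p + m)))

-- Inserting N at position p makes N the first entry of the suffix, so R
-- vanishes, unless the suffix has length one.
gluedAt-suc-pointwise : ∀ p m' α R → HeadMinOnly R → ∀ ρ → PermShape (p + suc m') ρ →
  glued p α R (ins p (suc (p + suc m')) ρ) ≡ 0
gluedAt-suc-pointwise p m' α R hz ρ (lenρ , al) =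
  trans (cong (λ z → b2n (isoᵇ (take (suc p) (ins p N ρ)) α) * R z) (drop-ins-= p N ρ le))
        (trans (cong (b2n (isoᵇ (take (suc p) (ins p N ρ)) α) *_) (hz N (drop p ρ) (notAllAbove (drop p ρ) pos (All-drop p (All.map s≤s al)))))
               (*-zeroʳ (b2n (isoᵇ (take (suc p) (ins p N ρ)) α))))
  where
  N = suc (p + suc m')
  le : p ≤ length ρ
  le rewrite lenρ = m≤m+n p (suc m')
  pos : 0 < length (drop p ρ)
  pos rewrite length-drop p ρ | lenρ | m+n∸m≡n p (suc m') = s≤s z≤n

gluedAt-suc : ∀ p m' α R → HeadMinOnly R → gluedAt p (suc m') α R ≡ 0
gluedAt-suc p m' α R hz = trans (sumL-congP (gluedAt-suc-pointwise p m' α R hz) (Perm-shape (p + suc m')))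
  (sumL-zero (Perm (p + suc m')))

gluedAt-zero-pointwise : ∀ p α R → length α ≡ suc p → Distinct α → IsoInvariant R → ∀ ρ → PermShape (p + 0) ρ →
  glued p α R (ins p (suc (p + 0)) ρ) ≡ b2n ((p ≡ᵇ argmax α) ∧ isoᵇ ρ (del (argmax α) α)) * R (1 ∷ [])
gluedAt-zero-pointwise p α R len d ri ρ (lenρ , al) =
  cong₂ (λ a b → b2n a * b) isoEq REq
  where
  N = suc (p + 0)
  lenρ' : length ρ ≡ p
  lenρ' = trans lenρ (+-identityʳ p)
  isoEq : isoᵇ (take (suc p) (ins p N ρ)) α ≡ ((p ≡ᵇ argmax α) ∧ isoᵇ ρ (del (argmax α) α))
  isoEq = trans (cong (λ z → isoᵇ z α)
    (trans (take-ins p p N ρ ≤-refl) (cong (ins p N) (take-all p ρ (≤-reflexive lenρ')))))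
                (iso-ins-bool p N ρ α (trans len (cong suc (sym lenρ'))) d (All.map s≤s al) (≤-reflexive (sym lenρ')))
  REq : R (drop p (ins p N ρ)) ≡ R (1 ∷ [])
  REq = trans (cong R (trans (drop-ins-= p N ρ (≤-reflexive (sym lenρ')))
    (cong (N ∷_) (drop-all p ρ (≤-reflexive lenρ'))))) (ri _ _ (Iso-singleton N 1))

gluedAt-zero : ∀ p α R → length α ≡ suc p → Distinct α → IsoInvariant R → gluedAt p 0 α R ≡
  sumL (λ ρ → b2n ((p ≡ᵇ argmax α) ∧ isoᵇ ρ (del (argmax α) α)) * R (1 ∷ [])) (Perm (p + 0))
gluedAt-zero p α R len d ri = sumL-congP (gluedAt-zero-pointwise p α R len d ri) (Perm-shape (p + 0))

-- Inserting N after position p leaves the window alone and inserts a new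
-- maximum into the suffix.
gluedAfter-pointwise : ∀ p m' α R → IsoInvariant R → ∀ ρ → PermShape (p + suc m') ρ →
  sumL (λ i → glued p α R (ins i (suc (p + suc m')) ρ)) (rng (suc p) (suc m')) ≡
    sumL (λ j → glued p α (withMaxAt R j) ρ) (rng 1 (suc m'))
gluedAfter-pointwise p m' α R ri ρ (lenρ , al) =
  trans (cong (λ z → sumL (λ i → glued p α R (ins i N ρ)) (rng z (suc m'))) (+-comm 1 p))
  (trans (sumL-rng-shift (λ i → glued p α R (ins i N ρ)) p 1 (suc m'))
  (sumL-congP {P = λ j → 1 ≤ j × j < 1 + suc m'} term (rng-All 1 (suc m'))))
  where
  N = suc (p + suc m')
  le1 : suc p ≤ length ρ
  le1 rewrite lenρ | +-suc p m' = s≤s (m≤m+n p m')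
  term : ∀ j → 1 ≤ j × j < 1 + suc m' → glued p α R (ins (p + j) N ρ) ≡ glued p α (withMaxAt R j) ρ
  term (suc j) _ = cong₂ (λ a b → b2n (isoᵇ a α) * b) (take-ins-> p j N ρ le1)
     (trans (cong R (drop-ins-> p (suc j) N ρ (≤-trans (n≤1+n p) le1))) (insertLarger≡withMaxAt R ri (suc j) N (drop p ρ) (All-drop p (All.map s≤s al))))

gluedAfter-zero : ∀ p α R → gluedAfter p 0 α R ≡ 0
gluedAfter-zero p α R = sumL-zero (Perm (p + 0))

gluedAfter-suc : ∀ p m' α R → IsoInvariant R → gluedAfter p (suc m') α R ≡
  sumL (λ j → sumL (glued p α (withMaxAt R j)) (Perm (p + suc m'))) (rng 1 (suc m'))
gluedAfter-suc p m' α R ri = trans (sumL-congP (gluedAfter-pointwise p m' α R ri) (Perm-shape (p + suc m')))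
  (sumL-swap (λ ρ j → glued p α (withMaxAt R j) ρ) (Perm (p + suc m')) (rng 1 (suc m')))

-- For R that vanishes unless the head is minimal, the new maximum of a
-- permutation of size m+2 is never in front, so Σ R splits over positions 1…m+1.
sumL-Perm-HeadMinOnly : ∀ m' R → IsoInvariant R → HeadMinOnly R → sumL R (Perm (suc (suc m'))) ≡
  sumL (λ j → sumL (withMaxAt R j) (Perm (suc m'))) (rng 1 (suc m'))
sumL-Perm-HeadMinOnly m' R ri hz = trans (sumL-Perm (suc m') R)
  (trans (sumL-congP {P = PermShape (suc m')} pt (Perm-shape (suc m')))
  (sumL-swap (λ τ j → withMaxAt R j τ) (Perm (suc m')) (rng 1 (suc m'))))
  where
  M = suc (suc m')
  pt : ∀ τ → PermShape (suc m') τ → sumL (λ i → R (ins i M τ)) (rng 0 M) ≡ sumL (λ j → withMaxAt R j τ) (rng 1 (suc m'))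
  pt τ (lenτ , al) = cong₂ _+_ (hz M τ (notAllAbove τ (subst (0 <_) (sym lenτ) (s≤s z≤n)) (All.map s≤s al)))
                               (sumL-congP {P = λ j → 1 ≤ j × j < 1 + suc m'} (λ j _ → insertLarger≡withMaxAt R ri j M τ (All.map s≤s al)) (rng-All 1 (suc m')))

gluedAfter-IH : ∀ p m' α R → IsoInvariant R → HeadMinOnly R →
  (∀ j → GluingIdentity p m' α (withMaxAt R (suc j))) →
  gluedAfter p (suc m') α R ≡ ((aboveLast α + m') C aboveLast α) * sumL R (Perm (suc (suc m')))
gluedAfter-IH p m' α R ri hz ih =
  begin
    gluedAfter p (suc m') α R
  ≡⟨ gluedAfter-suc p m' α R ri ⟩
    sumL (λ j → sumL (glued p α (withMaxAt R j)) (Perm (p + suc m'))) (rng 1 (suc m'))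
  ≡⟨ sumL-congP {P = λ j → 1 ≤ j × j < 1 + suc m'} step (rng-All 1 (suc m')) ⟩
    sumL (λ j → K * sumL (withMaxAt R j) (Perm (suc m'))) (rng 1 (suc m'))
  ≡⟨ sym (sumL-*ˡ K (λ j → sumL (withMaxAt R j) (Perm (suc m'))) (rng 1 (suc m'))) ⟩
    K * sumL (λ j → sumL (withMaxAt R j) (Perm (suc m'))) (rng 1 (suc m'))
  ≡⟨ cong (K *_) (sym (sumL-Perm-HeadMinOnly m' R ri hz)) ⟩
    K * sumL R (Perm (suc (suc m')))
  ∎
  where
  open ≡-Reasoning
  K = (aboveLast α + m') C aboveLast α
  step : ∀ j → 1 ≤ j × j < 1 + suc m' → sumL (glued p α (withMaxAt R j)) (Perm (p + suc m')) ≡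
    K * sumL (withMaxAt R j) (Perm (suc m'))
  step (suc j) _ = trans (cong (λ n → sumL (glued p α (withMaxAt R (suc j))) (Perm n)) (+-suc p m')) (ih j)

[n+0]Cn≡1 : ∀ n → (n + 0) C n ≡ 1
[n+0]Cn≡1 n rewrite +-identityʳ n = nCn≡1 n

-- The binomial coefficient appears
-- through Pascal's rule when the maximum of α is not the shared entry.
gluing-lt-zero : ∀ p' α R → length α ≡ suc (suc p') → Distinct α → IsoInvariant R → argmax α < suc p' →
  GluingIdentity p' 0 (dropMax α) R → GluingIdentity (suc p') 0 α R
gluing-lt-zero p' α R len d ri lt ih =
  begin
    sumL (glued (suc p') α R) (Perm (suc (suc p' + 0)))
  ≡⟨ glued-split (suc p') 0 α R ⟩
    gluedBefore (suc p') 0 α R + (gluedAt (suc p') 0 α R + gluedAfter (suc p') 0 α R)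
  ≡⟨ cong₂ _+_ (trans (gluedBefore-lt p' 0 α R len d lt) ih) (cong₂ _+_ atZero (gluedAfter-zero (suc p') α R)) ⟩
    ((aboveLast (dropMax α) + 0) C aboveLast (dropMax α)) * TT + 0
  ≡⟨ trans (+-identityʳ _) (cong (_* TT) (trans ([n+0]Cn≡1 (aboveLast (dropMax α))) (sym ([n+0]Cn≡1 (aboveLast α))))) ⟩
    ((aboveLast α + 0) C aboveLast α) * TT
  ∎
  where
  open ≡-Reasoning
  TT = sumL R (Perm 1)
  -- the maximum of α is not the shared entry, so N cannot be inserted there
  atZero : gluedAt (suc p') 0 α R ≡ 0
  atZero = trans (gluedAt-zero (suc p') α R len d ri)
                 (sumL-0 (Perm (suc p' + 0)) (λ ρ → cong (λ b → b2n (b ∧ isoᵇ ρ (dropMax α)) * R (1 ∷ []))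
                                                          (≡ᵇ-≢ (suc p') (argmax α) (λ e → <-irrefl (sym e) lt))))

gluing-eq-zero : ∀ p α R → length α ≡ suc p → Distinct α → IsoInvariant R → argmax α ≡ p → GluingIdentity p 0 α R
gluing-eq-zero p α R len d ri e =
  begin
    sumL (glued p α R) (Perm (suc (p + 0)))
  ≡⟨ glued-split p 0 α R ⟩
    gluedBefore p 0 α R + (gluedAt p 0 α R + gluedAfter p 0 α R)
  ≡⟨ cong₂ _+_ (gluedBefore-eq p 0 α R len d e) (cong₂ _+_ (gluedAt-zero p α R len d ri) (gluedAfter-zero p α R)) ⟩
    0 + (sumL (λ ρ → b2n ((p ≡ᵇ argmax α) ∧ isoᵇ ρ (dropMax α)) * R (1 ∷ [])) (Perm (p + 0)) + 0)
  ≡⟨ +-identityʳ _ ⟩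
    sumL (λ ρ → b2n ((p ≡ᵇ argmax α) ∧ isoᵇ ρ (dropMax α)) * R (1 ∷ [])) (Perm (p + 0))
  ≡⟨ cong (λ z → sumL (λ ρ → b2n ((p ≡ᵇ z) ∧ isoᵇ ρ (del z α)) * R (1 ∷ [])) (Perm (p + 0))) e ⟩
    sumL (λ ρ → b2n ((p ≡ᵇ p) ∧ isoᵇ ρ (del p α)) * R (1 ∷ [])) (Perm (p + 0))
  ≡⟨ cong (λ b → sumL (λ ρ → b2n (b ∧ isoᵇ ρ (del p α)) * R (1 ∷ [])) (Perm (p + 0))) (≡ᵇ-refl p) ⟩
    sumL (λ ρ → b2n (isoᵇ ρ (del p α)) * R (1 ∷ [])) (Perm (p + 0))
  ≡⟨ sym (sumL-*ʳ (R (1 ∷ [])) (λ ρ → b2n (isoᵇ ρ (del p α))) (Perm (p + 0))) ⟩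
    sumL (λ ρ → b2n (isoᵇ ρ (del p α))) (Perm (p + 0)) * R (1 ∷ [])
  ≡⟨ cong (_* R (1 ∷ [])) (rigidity (p + 0) (del p α) lenp (Distinct-del p α d)) ⟩
    1 * R (1 ∷ [])
  ≡⟨ binomial ⟩
    ((aboveLast α + 0) C aboveLast α) * (R (1 ∷ []) + 0)
  ∎
  where
  open ≡-Reasoning
  lenp : length (del p α) ≡ p + 0
  lenp = trans (suc-injective (trans (length-del p α (subst (p <_) (sym len) ≤-refl)) len)) (sym (+-identityʳ p))
  -- the shared entry is the maximum of α, so nothing lies above it
  binomial : 1 * R (1 ∷ []) ≡ ((aboveLast α + 0) C aboveLast α) * (R (1 ∷ []) + 0)
  binomial rewrite aboveLast-max α p len e = cong (_+ 0) (sym (+-identityʳ (R (1 ∷ []))))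

gluing-lt-suc : ∀ p' m' α R → length α ≡ suc (suc p') → Distinct α → IsoInvariant R → HeadMinOnly R →
  argmax α < suc p' →
  GluingIdentity p' (suc m') (dropMax α) R → (∀ j → GluingIdentity (suc p') m' α (withMaxAt R (suc j))) →
  GluingIdentity (suc p') (suc m') α R
gluing-lt-suc p' m' α R len d ri hz lt ihBefore ihAfter =
  begin
    sumL (glued (suc p') α R) (Perm (suc (suc p' + suc m')))
  ≡⟨ glued-split (suc p') (suc m') α R ⟩
    gluedBefore (suc p') (suc m') α R + (gluedAt (suc p') (suc m') α R + gluedAfter (suc p') (suc m') α R)
  ≡⟨ cong₂ _+_ (trans (gluedBefore-lt p' (suc m') α R len d lt) ihBefore)
               (cong₂ _+_ (gluedAt-suc (suc p') m' α R hz) (gluedAfter-IH (suc p') m' α R ri hz ihAfter)) ⟩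
    ((a' + suc m') C a') * TT + (0 + ((aboveLast α + m') C aboveLast α) * TT)
  ≡⟨ cong (λ z → ((a' + suc m') C a') * TT + ((z + m') C z) * TT) aEq ⟩
    ((a' + suc m') C a') * TT + ((suc a' + m') C suc a') * TT
  ≡⟨ sym (*-distribʳ-+ TT ((a' + suc m') C a') ((suc a' + m') C suc a')) ⟩
    (((a' + suc m') C a') + ((suc a' + m') C suc a')) * TT
  ≡⟨ cong (λ z → (((a' + suc m') C a') + (z C suc a')) * TT) (sym (+-suc a' m')) ⟩
    (((a' + suc m') C a') + ((a' + suc m') C suc a')) * TT
  ≡⟨ cong (_* TT) (nCk+nC[k+1]≡[n+1]C[k+1] (a' + suc m') a') ⟩
    ((suc a' + suc m') C suc a') * TT
  ≡⟨ cong (λ z → ((z + suc m') C z) * TT) (sym aEq) ⟩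
    ((aboveLast α + suc m') C aboveLast α) * TT
  ∎
  where
  open ≡-Reasoning
  TT = sumL R (Perm (suc (suc m')))
  a' = aboveLast (dropMax α)
  -- removing the maximum (which lies above the shared entry) lowers the count by one
  aEq : aboveLast α ≡ suc a'
  aEq = aboveLast-del α (argmax α) p' len (≤-pred lt) (argmax-strict' α (subst (0 <_) (sym len) (s≤s z≤n)) d)

gluing-eq-suc : ∀ p m' α R → length α ≡ suc p → Distinct α → IsoInvariant R → HeadMinOnly R → argmax α ≡ p →
  (∀ j → GluingIdentity p m' α (withMaxAt R (suc j))) → GluingIdentity p (suc m') α R
gluing-eq-suc p m' α R len d ri hz e ihAfter =
  begin
    sumL (glued p α R) (Perm (suc (p + suc m')))
  ≡⟨ glued-split p (suc m') α R ⟩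
    gluedBefore p (suc m') α R + (gluedAt p (suc m') α R + gluedAfter p (suc m') α R)
  ≡⟨ cong₂ _+_ (gluedBefore-eq p (suc m') α R len d e)
    (cong₂ _+_ (gluedAt-suc p m' α R hz) (gluedAfter-IH p m' α R ri hz ihAfter)) ⟩
    0 + (0 + ((aboveLast α + m') C aboveLast α) * TT)
  ≡⟨ cong (λ a → ((a + m') C a) * TT) a≡0 ⟩
    (m' C 0) * TT
  ≡⟨ cong (λ a → ((a + suc m') C a) * TT) (sym a≡0) ⟩
    ((aboveLast α + suc m') C aboveLast α) * TT
  ∎
  where
  open ≡-Reasoning
  TT = sumL R (Perm (suc (suc m')))
  a≡0 : aboveLast α ≡ 0
  a≡0 = aboveLast-max α p len e

gluing : ∀ p m α R → length α ≡ suc p → Distinct α → IsoInvariant R → HeadMinOnly R → GluingIdentity p m α R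
gluing p m α R len d ri hz with argmax-cases p α len
gluing zero m α R len d ri hz | inj₁ ()
gluing (suc p') zero α R len d ri hz | inj₁ lt =
  gluing-lt-zero p' α R len d ri lt (gluing p' 0 (dropMax α) R (proj₁ shape) (proj₂ shape) ri hz)
  where shape = dropMax-shape p' α len d
gluing (suc p') (suc m') α R len d ri hz | inj₁ lt =
  gluing-lt-suc p' m' α R len d ri hz lt (gluing p' (suc m') (dropMax α) R (proj₁ shape) (proj₂ shape) ri hz)
    (λ j → gluing (suc p') m' α (withMaxAt R (suc j)) len d (IsoInvariant-withMaxAt R ri (suc j)) (HeadMinOnly-withMaxAt R hz j))
  where shape = dropMax-shape p' α len d
gluing p zero α R len d ri hz | inj₂ e = gluing-eq-zero p α R len d ri e
gluing p (suc m') α R len d ri hz | inj₂ e =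
  gluing-eq-suc p m' α R len d ri hz e
    (λ j → gluing p m' α (withMaxAt R (suc j)) len d (IsoInvariant-withMaxAt R ri (suc j)) (HeadMinOnly-withMaxAt R hz j))

-- The pattern 15243.  'occ π i' says that 15243 occurs in π at position i, and
-- 'Occ w' is the explicit inequality form w₀ < w₂ < w₄ < w₃ < w₁ of an
-- occurrence at position 0.
occ : List ℕ → ℕ → Bool
occ π s = occursAtᵇ σ₁₅₂₄₃ π s

Occ : List ℕ → Set
Occ (x0 ∷ x1 ∷ x2 ∷ x3 ∷ x4 ∷ _) = (x0 < x2) × (x2 < x4) × (x4 < x3) × (x3 < x1)
Occ _ = ⊥

0<5 : 0 < 5
0<5 = s≤s z≤n

1<5 : 1 < 5
1<5 = s≤s (s≤s z≤n)

2<5 : 2 < 5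
2<5 = s≤s (s≤s (s≤s z≤n))

3<5 : 3 < 5
3<5 = s≤s (s≤s (s≤s (s≤s z≤n)))

4<5 : 4 < 5
4<5 = s≤s (s≤s (s≤s (s≤s (s≤s z≤n))))

IsoAt-σ⇒Occ : ∀ w → IsoAt (take 5 w) σ₁₅₂₄₃ → Occ w
IsoAt-σ⇒Occ (x0 ∷ x1 ∷ x2 ∷ x3 ∷ x4 ∷ r) (_ , pt) =
  <ᵇ≡true⇒< (pt 0 2 0<5 2<5) , <ᵇ≡true⇒< (pt 2 4 2<5 4<5) , <ᵇ≡true⇒< (pt 4 3 4<5 3<5) , <ᵇ≡true⇒< (pt 3 1 3<5 1<5)
IsoAt-σ⇒Occ [] (() , _)
IsoAt-σ⇒Occ (_ ∷ []) (() , _)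
IsoAt-σ⇒Occ (_ ∷ _ ∷ []) (() , _)
IsoAt-σ⇒Occ (_ ∷ _ ∷ _ ∷ []) (() , _)
IsoAt-σ⇒Occ (_ ∷ _ ∷ _ ∷ _ ∷ []) (() , _)

occursAt0⇒Occ : ∀ w → occursAtᵇ σ₁₅₂₄₃ w 0 ≡ true → Occ w
occursAt0⇒Occ w h = IsoAt-σ⇒Occ w (sameOrder⇒IsoAt (take 5 w) σ₁₅₂₄₃ h)

Occ⇒occursAt0 : ∀ w → Occ w → occursAtᵇ σ₁₅₂₄₃ w 0 ≡ true
Occ⇒occursAt0 (x0 ∷ x1 ∷ x2 ∷ x3 ∷ x4 ∷ r) (a , b , c , d)
  rewrite <⇒<ᵇ≡true a | <⇒<ᵇ≡true b | <⇒<ᵇ≡true c | <⇒<ᵇ≡true d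
        | <⇒<ᵇ≡true (<-trans a b) | <⇒<ᵇ≡true (<-trans b c) | <⇒<ᵇ≡true (<-trans c d)
        | <⇒<ᵇ≡true (<-trans a (<-trans b c)) | <⇒<ᵇ≡true (<-trans b (<-trans c d)) | <⇒<ᵇ≡true (<-trans a (<-trans b (<-trans c d)))
        | ≤⇒≮ᵇ (<⇒≤ a) | ≤⇒≮ᵇ (<⇒≤ b) | ≤⇒≮ᵇ (<⇒≤ c) | ≤⇒≮ᵇ (<⇒≤ d)
        | ≤⇒≮ᵇ (<⇒≤ (<-trans a b)) | ≤⇒≮ᵇ (<⇒≤ (<-trans b c)) | ≤⇒≮ᵇ (<⇒≤ (<-trans c d))
        | ≤⇒≮ᵇ (<⇒≤ (<-trans a (<-trans b c))) | ≤⇒≮ᵇ (<⇒≤ (<-trans b (<-trans c d))) | ≤⇒≮ᵇ (<⇒≤ (<-trans a (<-trans b (<-trans c d))))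
        | <ᵇ-irrefl x0 | <ᵇ-irrefl x1 | <ᵇ-irrefl x2 | <ᵇ-irrefl x3 | <ᵇ-irrefl x4 = refl

Occ-iso : ∀ u v → Iso u v → Occ u → Occ v
Occ-iso (x0 ∷ x1 ∷ x2 ∷ x3 ∷ x4 ∷ r) (y0 ∷ y1 ∷ y2 ∷ y3 ∷ y4 ∷ r') iso (a , b , c , d) with Iso⇒IsoAt _ _ iso
... | _ , pt = tr 0 2 {0<5} {2<5} a , tr 2 4 {2<5} {4<5} b , tr 4 3 {4<5} {3<5} c , tr 3 1 {3<5} {1<5} d
  where
  L5 : ∀ {k} → k < 5 → k < length (x0 ∷ x1 ∷ x2 ∷ x3 ∷ x4 ∷ r)
  L5 {k} lt = ≤-trans lt (s≤s (s≤s (s≤s (s≤s (s≤s z≤n)))))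
  tr : ∀ i j → {i< : i < 5} → {j< : j < 5} →
    at (x0 ∷ x1 ∷ x2 ∷ x3 ∷ x4 ∷ r) i < at (x0 ∷ x1 ∷ x2 ∷ x3 ∷ x4 ∷ r) j →
    at (y0 ∷ y1 ∷ y2 ∷ y3 ∷ y4 ∷ r') i < at (y0 ∷ y1 ∷ y2 ∷ y3 ∷ y4 ∷ r') j
  tr i j {i<} {j<} lt = <ᵇ≡true⇒< (trans (sym (pt i j (L5 i<) (L5 j<))) (<⇒<ᵇ≡true lt))
Occ-iso (_ ∷ _ ∷ _ ∷ _ ∷ _ ∷ _) (_ ∷ _ ∷ _ ∷ _ ∷ []) (_ , _ , _ , _ , ())
Occ-iso (_ ∷ _ ∷ _ ∷ _ ∷ _ ∷ _) (_ ∷ _ ∷ _ ∷ []) (_ , _ , _ , ())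
Occ-iso (_ ∷ _ ∷ _ ∷ _ ∷ _ ∷ _) (_ ∷ _ ∷ []) (_ , _ , ())
Occ-iso (_ ∷ _ ∷ _ ∷ _ ∷ _ ∷ _) (_ ∷ []) (_ , ())
Occ-iso (_ ∷ _ ∷ _ ∷ _ ∷ _ ∷ _) [] ()

occursAt⇒Occ : ∀ w s → occursAtᵇ σ₁₅₂₄₃ w s ≡ true → Occ (drop s w)
occursAt⇒Occ w s h = occursAt0⇒Occ (drop s w) h

Occ⇒occursAt : ∀ w s → Occ (drop s w) → occursAtᵇ σ₁₅₂₄₃ w s ≡ true
Occ⇒occursAt w s o = Occ⇒occursAt0 (drop s w) o

occ-resp : ∀ u v s → Iso u v → occursAtᵇ σ₁₅₂₄₃ u s ≡ occursAtᵇ σ₁₅₂₄₃ v s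
occ-resp u v s iso =
  bool-ext (λ h → Occ⇒occursAt v s (Occ-iso _ _ (Iso-drop s u v iso) (occursAt⇒Occ u s h)))
           (λ h → Occ⇒occursAt u s (Occ-iso _ _ (Iso-drop s v u (Iso-sym u v iso)) (occursAt⇒Occ v s h)))

occ-shift : ∀ a π s → occ π (a + s) ≡ occ (drop a π) s
occ-shift a π s = cong (λ z → sameOrderᵇ (take 5 z) σ₁₅₂₄₃) (sym (drop-drop a s π))

all-occ-shift : ∀ a π S → all (occ π) (map (a +_) S) ≡ all (occ (drop a π)) S
all-occ-shift a π S = trans (all-map (occ π) (a +_) S) (all-cong (occ-shift a π) S)

no-overlap-shift1 : ∀ w → Occ w → Occ (drop 1 w) → ⊥
no-overlap-shift1 (x0 ∷ x1 ∷ x2 ∷ x3 ∷ x4 ∷ x5 ∷ r) (a , b , c , d) (a' , _ , _ , _) = <-asym d a'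

no-overlap-shift3 : ∀ w → Occ w → Occ (drop 3 w) → ⊥
no-overlap-shift3 (x0 ∷ x1 ∷ x2 ∷ x3 ∷ x4 ∷ y2 ∷ y3 ∷ y4 ∷ r) (a , b , c , d) (a' , b' , c' , d') = <-asym c
  (<-trans a' (<-trans b' (<-trans c' d')))

HeadMin : List ℕ → Set
HeadMin [] = ⊤
HeadMin (x ∷ v) = All (x <_) v

HeadMin-single : ∀ w → Occ w → length w ≡ 5 → HeadMin w
HeadMin-single (x0 ∷ x1 ∷ x2 ∷ x3 ∷ x4 ∷ []) (a , b , c , d) _ =
  <-trans a (<-trans b (<-trans c d)) ∷ a ∷ <-trans a (<-trans b c) ∷ <-trans a b ∷ []

HeadMin-step2 : ∀ w → Occ w → HeadMin (drop 2 w) → HeadMin w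
HeadMin-step2 (x0 ∷ x1 ∷ x2 ∷ x3 ∷ x4 ∷ r) (a , b , c , d) (p ∷ ps) =
  <-trans a (<-trans b (<-trans c d)) ∷ a ∷ All.map (<-trans a) (p ∷ ps)

HeadMin-step4 : ∀ w → Occ w → HeadMin (drop 4 w) → HeadMin w
HeadMin-step4 (x0 ∷ x1 ∷ x2 ∷ x3 ∷ x4 ∷ r) (a , b , c , d) ps =
  <-trans a (<-trans b (<-trans c d)) ∷ a ∷ <-trans a (<-trans b c) ∷ <-trans a b ∷ All.map (<-trans (<-trans a b)) ps

headMinᵇ : List ℕ → Bool
headMinᵇ [] = true
headMinᵇ (x ∷ v) = all (x <ᵇ_) v

HeadMin⇒headMinᵇ : ∀ τ → HeadMin τ → headMinᵇ τ ≡ true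
HeadMin⇒headMinᵇ [] _ = refl
HeadMin⇒headMinᵇ (x ∷ v) al = all-intro (x <ᵇ_) v (λ m → <⇒<ᵇ≡true (All.lookup al m))

headMin-resp : ∀ u v → Iso u v → headMinᵇ u ≡ headMinᵇ v
headMin-resp [] [] _ = refl
headMin-resp (x ∷ u) (y ∷ v) (c , _) = all-Cmp x y u v c

-- Runs.  'run ℓ' = 0, 2, …, 2ℓ-2 is a run of ℓ occurrences at distance 2.  It
-- occupies 'runLength (ℓ-1)' = 2ℓ+3 entries, and occurrences at all positions of
-- the run mean exactly that the prefix is order-isomorphic to the fixed
-- pattern 'runPattern (ℓ-1)' = 1, 2ℓ+3, 2, 2ℓ+2, …; its last entry has ℓ+1
-- entries above it.
run : ℕ → List ℕ
run zero = []
run (suc ℓ) = 0 ∷ map (2 +_) (run ℓ)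

runLength : ℕ → ℕ
runLength zero = 3
runLength (suc ℓ) = suc (suc (runLength ℓ))

runLength≡ : ∀ ℓ → runLength ℓ ≡ suc (2 * ℓ + 2)
runLength≡ zero = refl
runLength≡ (suc ℓ) = trans (cong (λ z → suc (suc z)) (runLength≡ ℓ)) (runLength-step ℓ)
  where
  runLength-step : ∀ ℓ → suc (suc (suc (2 * ℓ + 2))) ≡ suc (2 * suc ℓ + 2)
  runLength-step = solve-∀

runLength≥ : ∀ ℓ → suc (suc (suc ℓ)) ≤ runLength ℓ
runLength≥ zero = ≤-refl
runLength≥ (suc ℓ) = ≤-trans (s≤s (runLength≥ ℓ)) (n≤1+n _)

length-run : ∀ ℓ → length (run ℓ) ≡ ℓ
length-run zero = refl
length-run (suc ℓ) = cong suc (trans (length-map (2 +_) (run ℓ)) (length-run ℓ))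

runPattern : ℕ → List ℕ
runPattern zero = 1 ∷ 3 ∷ 2 ∷ []
runPattern (suc ℓ) = 1 ∷ runLength (suc ℓ) ∷ map suc (runPattern ℓ)

length-runPattern : ∀ ℓ → length (runPattern ℓ) ≡ runLength ℓ
length-runPattern zero = refl
length-runPattern (suc ℓ) = cong (λ z → suc (suc z)) (trans (length-map suc (runPattern ℓ)) (length-runPattern ℓ))

runPattern-range : ∀ ℓ → All (λ v → 1 ≤ v × v ≤ runLength ℓ) (runPattern ℓ)
runPattern-range zero = (s≤s z≤n , s≤s z≤n) ∷ (s≤s z≤n , ≤-refl) ∷ (s≤s z≤n , s≤s (s≤s z≤n)) ∷ []
runPattern-range (suc ℓ) = (s≤s z≤n , s≤s z≤n) ∷ (s≤s z≤n , ≤-refl) ∷ All-map suc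
  (λ v (a , b) → s≤s z≤n , ≤-trans (s≤s b) (n≤1+n _)) (runPattern-range ℓ)

Distinct-runPattern : ∀ ℓ → Distinct (runPattern ℓ)
Distinct-runPattern zero = ((λ ()) ∷ (λ ()) ∷ []) , ((λ ()) ∷ []) , [] , tt
Distinct-runPattern (suc ℓ) = ((λ ()) ∷ All-map suc (λ v (a , b) e → <-irrefl e (s≤s a)) (runPattern-range ℓ)) ,
                      (All-map suc (λ v (a , b) e → <-irrefl (sym e) (s≤s (s≤s b))) (runPattern-range ℓ)) ,
                      Distinct-map-suc (runPattern ℓ) (Distinct-runPattern ℓ)

last-runPattern : ∀ ℓ → at (runPattern ℓ) (pred (runLength ℓ)) ≡ suc (suc ℓ)
last-runPattern zero = refl
last-runPattern (suc ℓ) = trans (cong (at (runLength (suc ℓ) ∷ map suc (runPattern ℓ))) (sym (suc-pred-runLength ℓ)))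
  (trans (at-map-suc (runPattern ℓ) (pred (runLength ℓ)) lt) (cong suc (last-runPattern ℓ)))
  where
  suc-pred-runLength : ∀ ℓ → suc (pred (runLength ℓ)) ≡ runLength ℓ
  suc-pred-runLength zero = refl
  suc-pred-runLength (suc ℓ) = refl
  lt : pred (runLength ℓ) < length (runPattern ℓ)
  lt rewrite length-runPattern ℓ | sym (suc-pred-runLength ℓ) = ≤-refl

countAbove-map-suc : ∀ t xs → countAbove (suc t) (map suc xs) ≡ countAbove t xs
countAbove-map-suc t [] = refl
countAbove-map-suc t (x ∷ xs) = cong (b2n (t <ᵇ x) +_) (countAbove-map-suc t xs)

countAbove-runPattern : ∀ ℓ → countAbove (suc (suc ℓ)) (runPattern ℓ) ≡ suc ℓ
countAbove-runPattern zero = refl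
countAbove-runPattern (suc ℓ) rewrite <⇒<ᵇ≡true {suc (suc (suc ℓ))} {suc (suc (runLength ℓ))}
  (s≤s (s≤s (≤-trans (n≤1+n (suc (suc ℓ))) (runLength≥ ℓ)))) | countAbove-map-suc (suc (suc ℓ))
  (runPattern ℓ) | countAbove-runPattern ℓ = refl

aboveLast-runPattern : ∀ ℓ → aboveLast (runPattern ℓ) ≡ suc ℓ
aboveLast-runPattern ℓ rewrite length-runPattern ℓ | last-runPattern ℓ = countAbove-runPattern ℓ

-- 'runPattern 1' is 15243 itself.
iso-runPattern1⇒Occ : ∀ π → isoᵇ (take 5 π) (runPattern 1) ≡ true → Occ π
iso-runPattern1⇒Occ π h = IsoAt-σ⇒Occ π (Iso⇒IsoAt (take 5 π) σ₁₅₂₄₃ (isoᵇ⇒ _ _ h))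

Occ⇒iso-runPattern1 : ∀ π → Occ π → isoᵇ (take 5 π) (runPattern 1) ≡ true
Occ⇒iso-runPattern1 π o = ⇒isoᵇ _ _
  (IsoAt⇒Iso (take 5 π) σ₁₅₂₄₃ (sameOrder⇒IsoAt (take 5 π) σ₁₅₂₄₃ (Occ⇒occursAt0 π o)))

runOccurrences-one : ∀ π → all (occ π) (run 1) ≡ isoᵇ (take (runLength 1) π) (runPattern 1)
runOccurrences-one π = bool-ext (λ h → Occ⇒iso-runPattern1 π (occursAt0⇒Occ π (proj₁ (∧-elim {occ π 0} h))))
                     (λ h → ∧-intro (Occ⇒occursAt0 π (iso-runPattern1⇒Occ π h)) refl)

runPattern-middle : ∀ ℓ y0 y1 y2 r → Iso (y0 ∷ y1 ∷ take (runLength ℓ) (y2 ∷ r)) (runPattern (suc ℓ)) →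
  (y0 < y2) × (y2 < y1)
runPattern-middle zero y0 y1 y2 r ((_ , _ , e , _) , (_ , e' , _) , _) = <ᵇ≡true⇒< e , <ᵇ≡true⇒< e'
runPattern-middle (suc ℓ) y0 y1 y2 r ((_ , _ , e , _) , (_ , e' , _) , _) = <ᵇ≡true⇒< e , <ᵇ≡true⇒< e'

runPattern-tail-bounds : ∀ ℓ → All (1 <_) (runLength (suc ℓ) ∷ map suc (runPattern ℓ)) × All
  (_< runLength (suc ℓ)) (map suc (runPattern ℓ))
runPattern-tail-bounds ℓ = (s≤s (s≤s z≤n) ∷ All-map suc (λ v (a , b) → s≤s a) (runPattern-range ℓ)) ,
             All-map suc (λ v (a , b) → s≤s (s≤s b)) (runPattern-range ℓ)

-- One more step of the run: an occurrence at 0 followed by a run matching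
-- 'runPattern (ℓ+1)' from position 2 is the same as a prefix matching
-- 'runPattern (ℓ+2)', whose first two entries are the minimum and maximum.
runOccurrences-step⇒ : ∀ ℓ x0 x1 π' → Occ (x0 ∷ x1 ∷ π') → Iso (take (runLength (suc ℓ)) π') (runPattern (suc ℓ)) →
  Iso (x0 ∷ x1 ∷ take (runLength (suc ℓ)) π') (runPattern (suc (suc ℓ)))
runOccurrences-step⇒ ℓ x0 x1 [] () iso
runOccurrences-step⇒ ℓ x0 x1 (y0 ∷ []) () iso
runOccurrences-step⇒ ℓ x0 x1 (y0 ∷ y1 ∷ []) () iso
runOccurrences-step⇒ ℓ x0 x1 (y0 ∷ y1 ∷ y2 ∷ π'') (x0<y0 , _ , _ , y1<x1) iso@(c0 , c1 , iso'') =
  (<⇒<ᵇ≡true x0<x1 , ≤⇒≮ᵇ (<⇒≤ x0<x1) , Cmp-bottom⇐ x0 w A allx0 (All.map proj₁ (runPattern-range (suc ℓ))) lenw) ,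
  Cmp-top⇐ x1 (runLength (suc ℓ)) w A allx1 (All.map proj₂ (runPattern-range (suc ℓ))) lenw ,
  Iso-map-suc⇐ w A iso
  where
  w = take (runLength (suc ℓ)) (y0 ∷ y1 ∷ y2 ∷ π'')
  A = runPattern (suc ℓ)
  lenw : length w ≡ length A
  lenw = Iso-len w A iso
  up : All (y0 <_) (y1 ∷ take (runLength ℓ) (y2 ∷ π''))
  up = Cmp-up y0 1 (y1 ∷ take (runLength ℓ) (y2 ∷ π'')) (runLength (suc ℓ) ∷ map suc (runPattern ℓ)) c0
    (proj₁ (runPattern-tail-bounds ℓ))
  down : All (_< y1) (take (runLength ℓ) (y2 ∷ π''))
  down = Cmp-down y1 (runLength (suc ℓ)) (take (runLength ℓ) (y2 ∷ π'')) (map suc (runPattern ℓ)) c1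
    (proj₂ (runPattern-tail-bounds ℓ))
  y0<y1 : y0 < y1
  y0<y1 with up
  ... | p ∷ _ = p
  x0<x1 : x0 < x1
  x0<x1 = <-trans x0<y0 (<-trans y0<y1 y1<x1)
  allx0 : All (x0 <_) w
  allx0 = x0<y0 ∷ All.map (<-trans x0<y0) up
  allx1 : All (_< x1) w
  allx1 = <-trans y0<y1 y1<x1 ∷ y1<x1 ∷ All.map (λ z → <-trans z y1<x1) down

runOccurrences-step⇐ : ∀ ℓ x0 x1 π' → Iso (x0 ∷ x1 ∷ take (runLength (suc ℓ)) π') (runPattern (suc (suc ℓ))) →
  Occ (x0 ∷ x1 ∷ π') × Iso (take (runLength (suc ℓ)) π') (runPattern (suc ℓ))
runOccurrences-step⇐ ℓ x0 x1 π' ((e1 , e2 , cb) , c1 , iso) = occ0 π' allx0 allx1 isoA , isoA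
  where
  w = take (runLength (suc ℓ)) π'
  A = runPattern (suc ℓ)
  allx0 : All (x0 <_) w
  allx0 = Cmp-bottom⇒ x0 w A cb (All.map proj₁ (runPattern-range (suc ℓ)))
  allx1 : All (_< x1) w
  allx1 = Cmp-top⇒ x1 (runLength (suc ℓ)) w A c1 (All.map proj₂ (runPattern-range (suc ℓ)))
  isoA : Iso w A
  isoA = Iso-map-suc⇒ w A iso
  occ0 : ∀ π' → All (x0 <_) (take (runLength (suc ℓ)) π') → All (_< x1) (take (runLength (suc ℓ)) π') →
    Iso (take (runLength (suc ℓ)) π') A → Occ (x0 ∷ x1 ∷ π')
  occ0 (y0 ∷ y1 ∷ y2 ∷ r) (a0 ∷ _) (_ ∷ b1 ∷ _) i with runPattern-middle ℓ y0 y1 y2 r i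
  ... | l1 , l2 = a0 , l1 , l2 , b1
  occ0 [] _ _ ()
  occ0 (y0 ∷ []) _ _ (() , _)
  occ0 (y0 ∷ y1 ∷ []) _ _ i = ⊥-elim
    (4+ℓ≰2 (≤-trans (runLength≥ (suc ℓ))
    (≤-trans (≤-reflexive (sym (trans (Iso-len _ _ i) (length-runPattern (suc ℓ)))))
    (length-take≤ (runLength (suc ℓ)) (y0 ∷ y1 ∷ [])))))
    where
    4+ℓ≰2 : suc (suc (suc (suc ℓ))) ≤ 2 → ⊥
    4+ℓ≰2 (s≤s (s≤s ()))

runOccurrences : ∀ ℓ π → all (occ π) (run (suc ℓ)) ≡ isoᵇ (take (runLength (suc ℓ)) π) (runPattern (suc ℓ))
runOccurrences zero π = runOccurrences-one π
runOccurrences (suc ℓ) [] = refl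
runOccurrences (suc ℓ) (x0 ∷ []) = refl
runOccurrences (suc ℓ) (x0 ∷ x1 ∷ π') =
  trans (cong (occ (x0 ∷ x1 ∷ π') 0 ∧_) (trans (all-occ-shift 2 (x0 ∷ x1 ∷ π') (run (suc ℓ))) (runOccurrences ℓ π')))
        (bool-ext f g)
  where
  π = x0 ∷ x1 ∷ π'
  f : (occ π 0 ∧ isoᵇ (take (runLength (suc ℓ)) π') (runPattern (suc ℓ))) ≡ true →
    isoᵇ (x0 ∷ x1 ∷ take (runLength (suc ℓ)) π') (runPattern (suc (suc ℓ))) ≡ true
  f h = ⇒isoᵇ _ _ (runOccurrences-step⇒ ℓ x0 x1 π' (occursAt0⇒Occ π (proj₁ (∧-elim {occ π 0} h)))
    (isoᵇ⇒ _ _ (proj₂ (∧-elim {occ π 0} h))))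
  g : isoᵇ (x0 ∷ x1 ∷ take (runLength (suc ℓ)) π') (runPattern (suc (suc ℓ))) ≡ true →
    (occ π 0 ∧ isoᵇ (take (runLength (suc ℓ)) π') (runPattern (suc ℓ))) ≡ true
  g h with runOccurrences-step⇐ ℓ x0 x1 π' (isoᵇ⇒ _ _ h)
  ... | o , i = ∧-intro (Occ⇒occursAt0 π o) (⇒isoᵇ _ _ i)

-- The marked occurrence sets of a cluster of
-- length n are the increasing lists S ⊆ {0,…,n-5} that cover every entry and
-- whose successive elements differ by less than 5.  'markings n k' lists those
-- of size k which avoid the impossible distances 1 and 3.
Inc : ℕ → List ℕ → Set
Inc lo [] = ⊤
Inc lo (x ∷ S) = (lo ≤ x) × Inc (suc x) S

Inc-weaken : ∀ {lo lo'} S → lo' ≤ lo → Inc lo S → Inc lo' S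
Inc-weaken [] _ _ = tt
Inc-weaken (x ∷ S) le (a , i) = ≤-trans le a , i

Inc-All : ∀ lo S → Inc lo S → All (lo ≤_) S
Inc-All lo [] _ = []
Inc-All lo (x ∷ S) (a , i) = a ∷ All.map (λ b → ≤-trans a (<⇒≤ b)) (Inc-All (suc x) S i)

Inc-head≤ : ∀ lo x S {i} → Inc lo (x ∷ S) → i ∈ (x ∷ S) → x ≤ i
Inc-head≤ lo x S inc (here refl) = ≤-refl
Inc-head≤ lo x S (_ , inc) (there m) = <⇒≤ (All.lookup (Inc-All (suc x) S inc) m)

∈sublists-range⇒ : ∀ a L S → S ∈ sublists (rng a L) → Inc a S × All (_< a + L) S
∈sublists-range⇒ a zero .[] (here refl) = tt , []
∈sublists-range⇒ a (suc L) S m with ∈-++⁻ (map (a ∷_) (sublists (rng (suc a) L))) m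
... | inj₁ m1 with ∈-map⁻ (a ∷_) m1
... | S' , m2 , refl with ∈sublists-range⇒ (suc a) L S' m2
... | i , al = (≤-refl , i) , (subst (a <_) (sym (+-suc a L)) (s≤s (m≤m+n a L))) ∷ All.map
  (λ {x} lt → subst (x <_) (sym (+-suc a L)) lt) al
∈sublists-range⇒ a (suc L) S m | inj₂ m1 with ∈sublists-range⇒ (suc a) L S m1
... | i , al = Inc-weaken S (n≤1+n a) i , All.map (λ {x} lt → subst (x <_) (sym (+-suc a L)) lt) al

[]∈sublists : ∀ (xs : List ℕ) → [] ∈ sublists xs
[]∈sublists [] = here refl
[]∈sublists (x ∷ xs) = ∈-++⁺ʳ (map (x ∷_) (sublists xs)) ([]∈sublists xs)

∈sublists-range⇐ : ∀ a L S → Inc a S → All (_< a + L) S → S ∈ sublists (rng a L)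
∈sublists-range⇐ a L [] _ _ = []∈sublists (rng a L)
∈sublists-range⇐ a zero (x ∷ S) (a≤x , _) (x< ∷ _) = ⊥-elim
  (<-irrefl refl (≤-trans x< (subst (_≤ x) (sym (+-identityʳ a)) a≤x)))
∈sublists-range⇐ a (suc L) (x ∷ S) (a≤x , i) (x< ∷ al) with a ≟ x
... | yes refl = ∈-++⁺ˡ (∈-map⁺ (a ∷_)
  (∈sublists-range⇐ (suc a) L S i (All.map (λ {y} lt → subst (y <_) (+-suc a L) lt) al)))
... | no a≢x = ∈-++⁺ʳ (map (a ∷_) (sublists (rng (suc a) L)))
  (∈sublists-range⇐ (suc a) L (x ∷ S) (≤∧≢⇒< a≤x a≢x , i) (All.map (λ {y} lt → subst (y <_) (+-suc a L) lt) (x< ∷ al)))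

Unique-sublists-range : ∀ a L → Unique (sublists (rng a L))
Unique-sublists-range a zero = [] ∷ []
Unique-sublists-range a (suc L) = Unique.++⁺
  (Unique.map⁺ (λ e → ∷-injectiveʳ e) (Unique-sublists-range (suc a) L)) (Unique-sublists-range (suc a) L) disj
  where
  disj : ∀ {v} → ¬ (v ∈ map (a ∷_) (sublists (rng (suc a) L)) × v ∈ sublists (rng (suc a) L))
  disj (m1 , m2) with ∈-map⁻ (a ∷_) m1
  ... | S' , _ , refl with ∈sublists-range⇒ (suc a) L (a ∷ S') m2
  ... | (a<a , _) , _ = <-irrefl refl a<a

markingᵇ : ℕ → ℕ → List ℕ → Bool
markingᵇ n k S = (length S ≡ᵇ k) ∧ (coveredᵇ 5 n S ∧ successiveOverlapᵇ 5 S)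

noShift13ᵇ : List ℕ → Bool
noShift13ᵇ [] = true
noShift13ᵇ (i ∷ []) = true
noShift13ᵇ (i ∷ i' ∷ is) = not (i' ≡ᵇ suc i) ∧ (not (i' ≡ᵇ 3 + i) ∧ noShift13ᵇ (i' ∷ is))

markings : ℕ → ℕ → List (List ℕ)
markings n k = filterᵇ (λ S → markingᵇ n k S ∧ noShift13ᵇ S) (sublists (upTo (suc (n ∸ 5))))

-- Actual occurrences are never at distance 1 or 3, so discarding those sets
-- loses nothing.
occurrences-noShift13 : ∀ π S → all (occ π) S ≡ true → noShift13ᵇ S ≡ true
occurrences-noShift13 π [] h = refl
occurrences-noShift13 π (i ∷ []) h = refl
occurrences-noShift13 π (i ∷ i' ∷ is) h =
  ∧-intro (notTrue (i' ≡ᵇ suc i) (λ e1 →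
    no-overlap-shift1 (drop i π) (occursAt⇒Occ π i oi)
    (subst Occ (trans (cong (λ z → drop z π) (trans (≡ᵇ≡true⇒≡ {i'} e1) (+-comm 1 i)))
    (sym (drop-drop i 1 π))) (occursAt⇒Occ π i' oi'))))
  (∧-intro (notTrue (i' ≡ᵇ 3 + i)
    (λ e3 → no-overlap-shift3 (drop i π) (occursAt⇒Occ π i oi)
    (subst Occ (trans (cong (λ z → drop z π) (trans (≡ᵇ≡true⇒≡ {i'} e3) (+-comm 3 i)))
    (sym (drop-drop i 3 π))) (occursAt⇒Occ π i' oi'))))
           (occurrences-noShift13 π (i' ∷ is) h'))
  where
  oi = proj₁ (∧-elim {occ π i} h)
  h' = proj₂ (∧-elim {occ π i} h)
  oi' = proj₁ (∧-elim {occ π i'} h')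

data Chain : ℕ → List ℕ → Set where
  single : ∀ a → Chain a (a ∷ [])
  step2 : ∀ a S → Chain (2 + a) S → Chain a (a ∷ S)
  step4 : ∀ a S → Chain (4 + a) S → Chain a (a ∷ S)

lastL : List ℕ → ℕ
lastL [] = 0
lastL (x ∷ []) = x
lastL (x ∷ y ∷ ys) = lastL (y ∷ ys)

lastL-cons : ∀ x S → 0 < length S → lastL (x ∷ S) ≡ lastL S
lastL-cons x (y ∷ S) _ = refl

lastL∈ : ∀ x S → lastL (x ∷ S) ∈ (x ∷ S)
lastL∈ x [] = here refl
lastL∈ x (y ∷ S) = there (lastL∈ y S)

lastL-++ : ∀ (U T : List ℕ) → 0 < length T → lastL (U ++ T) ≡ lastL T
lastL-++ [] T _ = refl
lastL-++ (x ∷ []) (y ∷ T) _ = refl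
lastL-++ (x ∷ x' ∷ U) T lt = lastL-++ (x' ∷ U) T lt

lastL-map : ∀ c (S : List ℕ) → 0 < length S → lastL (map (c +_) S) ≡ c + lastL S
lastL-map c (x ∷ []) _ = refl
lastL-map c (x ∷ y ∷ S) _ = lastL-map c (y ∷ S) (s≤s z≤n)

Inc-last : ∀ lo S → Inc lo S → All (_≤ lastL S) S
Inc-last lo [] _ = []
Inc-last lo (x ∷ []) _ = ≤-refl ∷ []
Inc-last lo (x ∷ y ∷ S) (a , i) with Inc-last (suc x) (y ∷ S) i
... | (y≤ ∷ rest) = ≤-trans (<⇒≤ (proj₁ i)) y≤ ∷ y≤ ∷ rest

Chain-Inc : ∀ {a S} → Chain a S → Inc a S
Chain-Inc (single a) = ≤-refl , tt
Chain-Inc (step2 a S g) = ≤-refl , Inc-weaken S (n≤1+n (suc a)) (Chain-Inc g)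
Chain-Inc (step4 a S g) = ≤-refl , Inc-weaken S
  (≤-trans (n≤1+n (suc a)) (≤-trans (n≤1+n (2 + a)) (n≤1+n (3 + a)))) (Chain-Inc g)

Chain-nonempty : ∀ {a S} → Chain a S → 0 < length S
Chain-nonempty (single a) = s≤s z≤n
Chain-nonempty (step2 a S g) = s≤s z≤n
Chain-nonempty (step4 a S g) = s≤s z≤n

Chain-cons : ∀ {a S} → Chain a S → ∃ λ r → S ≡ a ∷ r
Chain-cons (single _) = [] , refl
Chain-cons (step2 _ r _) = r , refl
Chain-cons (step4 _ r _) = r , refl

Chain-head : ∀ {c b T} → Chain c (b ∷ T) → b ≡ c
Chain-head (single _) = refl
Chain-head (step2 _ _ _) = refl
Chain-head (step4 _ _ _) = refl

Chain-overlap : ∀ {a S} → Chain a S → successiveOverlapᵇ 5 S ≡ true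
Chain-overlap (single a) = refl
Chain-overlap (step2 a (b ∷ S) g) with Chain-head g
... | refl = ∧-intro (<⇒<ᵇ≡true (subst (_< a + 5) (+-comm a 2) (+-monoʳ-< a (s≤s (s≤s (s≤s z≤n)))))) (Chain-overlap g)
Chain-overlap (step4 a (b ∷ S) g) with Chain-head g
... | refl = ∧-intro (<⇒<ᵇ≡true
  (subst (_< a + 5) (+-comm a 4) (+-monoʳ-< a (s≤s (s≤s (s≤s (s≤s (s≤s z≤n)))))))) (Chain-overlap g)

Chain-noShift13 : ∀ {a S} → Chain a S → noShift13ᵇ S ≡ true
Chain-noShift13 (single a) = refl
Chain-noShift13 (step2 a (b ∷ S) g) with Chain-head g
... | refl rewrite ≡ᵇ-≢ (suc a) a 1+n≢n | ≡ᵇ-≢ a (suc a) (λ e → 1+n≢n (sym e)) = Chain-noShift13 g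
Chain-noShift13 (step4 a (b ∷ S) g) with Chain-head g
... | refl rewrite ≡ᵇ-≢ (suc (suc (suc a))) a
  (λ e → <-irrefl (sym e) (s≤s (≤-trans (n≤1+n a) (n≤1+n (suc a))))) | ≡ᵇ-≢ (suc a) a 1+n≢n = Chain-noShift13 g

Chain-covers : ∀ {a S} → Chain a S → ∀ j → a ≤ j → j < lastL S + 5 → any (λ i → (i ≤ᵇ j) ∧ (j <ᵇ i + 5)) S ≡ true
Chain-covers (single a) j a≤j j< = any-intro (λ i → (i ≤ᵇ j) ∧ (j <ᵇ i + 5)) (a ∷ []) (here refl)
  (∧-intro (≤⇒≤ᵇ≡true a≤j) (<⇒<ᵇ≡true j<))
Chain-covers (step2 a (b ∷ S) g) j a≤j j< with j <? a + 5
... | yes lt = any-intro (λ i → (i ≤ᵇ j) ∧ (j <ᵇ i + 5)) (a ∷ b ∷ S) (here refl)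
  (∧-intro (≤⇒≤ᵇ≡true a≤j) (<⇒<ᵇ≡true lt))
... | no nlt = any-there (λ i → (i ≤ᵇ j) ∧ (j <ᵇ i + 5)) a (b ∷ S)
  (Chain-covers g j (≤-trans (≤-trans (≤-reflexive (+-comm 2 a)) (+-monoʳ-≤ a (s≤s (s≤s z≤n)))) (≮⇒≥ nlt)) j<)
Chain-covers (step4 a (b ∷ S) g) j a≤j j< with j <? a + 5
... | yes lt = any-intro (λ i → (i ≤ᵇ j) ∧ (j <ᵇ i + 5)) (a ∷ b ∷ S) (here refl)
  (∧-intro (≤⇒≤ᵇ≡true a≤j) (<⇒<ᵇ≡true lt))
... | no nlt = any-there (λ i → (i ≤ᵇ j) ∧ (j <ᵇ i + 5)) a (b ∷ S)
  (Chain-covers g j (≤-trans (≤-trans (≤-reflexive (+-comm 4 a)) (+-monoʳ-≤ a (s≤s (s≤s (s≤s (s≤s z≤n))))))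
  (≮⇒≥ nlt)) j<)

Chain-shiftUp : ∀ c {a S} → Chain a S → Chain (c + a) (map (c +_) S)
Chain-shiftUp c (single a) = single (c + a)
Chain-shiftUp c (step2 a S g) = step2 (c + a) (map (c +_) S)
  (subst (λ z → Chain z (map (c +_) S)) (+-exchange c 2 a) (Chain-shiftUp c g))
Chain-shiftUp c (step4 a S g) = step4 (c + a) (map (c +_) S)
  (subst (λ z → Chain z (map (c +_) S)) (+-exchange c 4 a) (Chain-shiftUp c g))

Chain-shiftDown : ∀ {b T} → Chain b T → ∀ c a → b ≡ c + a → ∃ λ S' → (T ≡ map (c +_) S') × Chain a S'
Chain-shiftDown (single b) c a refl = a ∷ [] , refl , single a
Chain-shiftDown (step2 b T g) c a refl with Chain-shiftDown g c (2 + a) (+-exchange 2 c a)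
... | S' , e , g' = a ∷ S' , cong ((c + a) ∷_) e , step2 a S' g'
Chain-shiftDown (step4 b T g) c a refl with Chain-shiftDown g c (4 + a) (+-exchange 4 c a)
... | S' , e , g' = a ∷ S' , cong ((c + a) ∷_) e , step4 a S' g'

small-gap-cases : ∀ x y → x < y → y < x + 5 → (y ≡ 1 + x) ⊎ (y ≡ 2 + x) ⊎ (y ≡ 3 + x) ⊎ (y ≡ 4 + x)
small-gap-cases x y x<y y< = go (y ∸ x) (trans (+-comm (y ∸ x) x) (m+[n∸m]≡n (<⇒≤ x<y))) (m<n⇒0<n∸m x<y)
  (+-cancelˡ-< x _ _ (subst (_< x + 5) (sym (m+[n∸m]≡n (<⇒≤ x<y))) y<))
  where
  go : ∀ d → d + x ≡ y → 0 < d → d < 5 → (y ≡ 1 + x) ⊎ (y ≡ 2 + x) ⊎ (y ≡ 3 + x) ⊎ (y ≡ 4 + x)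
  go 1 e _ _ = inj₁ (sym e)
  go 2 e _ _ = inj₂ (inj₁ (sym e))
  go 3 e _ _ = inj₂ (inj₂ (inj₁ (sym e)))
  go 4 e _ _ = inj₂ (inj₂ (inj₂ (sym e)))
  go (suc (suc (suc (suc (suc d))))) e _ (s≤s (s≤s (s≤s (s≤s (s≤s ())))))

Chain-fromConditions : ∀ lo x S → Inc lo (x ∷ S) → successiveOverlapᵇ 5 (x ∷ S) ≡ true → noShift13ᵇ (x ∷ S) ≡
  true → Chain x (x ∷ S)
Chain-fromConditions lo x [] _ _ _ = single x
Chain-fromConditions lo x (y ∷ S) (_ , (x<y , inc)) ov nb with ∧-elim {y <ᵇ x + 5} ov | ∧-elim {not (y ≡ᵇ suc x)} nb
... | (y< , ov') | (n1 , n2) with ∧-elim {not (y ≡ᵇ 3 + x)} n2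
... | (n3 , nb') with small-gap-cases x y x<y (<ᵇ≡true⇒< y<)
... | inj₁ refl = ⊥-elim (true≢false (trans (sym (≡ᵇ-refl (suc x))) (not≡true n1)))
... | inj₂ (inj₁ refl) = step2 x (y ∷ S) (Chain-fromConditions (suc x) y S (x<y , inc) ov' nb')
... | inj₂ (inj₂ (inj₁ refl)) = ⊥-elim (true≢false (trans (sym (≡ᵇ-refl (3 + x))) (not≡true n3)))
... | inj₂ (inj₂ (inj₂ refl)) = step4 x (y ∷ S) (Chain-fromConditions (suc x) y S (x<y , inc) ov' nb')

coveredᵇ-elim : ∀ n S → coveredᵇ 5 n S ≡ true → ∀ j → j < n → ∃ λ i → i ∈ S × i ≤ j × j < i + 5
coveredᵇ-elim n S h j j<n with any-elim _ S (all-elim _ (upTo n) h (∈-upTo⁺ j<n))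
... | i , m , e with ∧-elim {i ≤ᵇ j} e
... | e1 , e2 = i , m , ≤ᵇ≡true⇒≤ e1 , <ᵇ≡true⇒< e2

markingConditions⇒Chain : ∀ n S → 5 ≤ n → Inc 0 S → All (_< 0 + suc (n ∸ 5)) S → coveredᵇ 5 n S ≡ true →
  successiveOverlapᵇ 5 S ≡ true → noShift13ᵇ S ≡ true → Chain 0 S × lastL S ≡ n ∸ 5
markingConditions⇒Chain n [] 5≤n inc allN cov ov nb with coveredᵇ-elim n [] cov 0 (≤-trans (s≤s z≤n) 5≤n)
... | i , () , _
markingConditions⇒Chain (suc n') (x ∷ S') 5≤n inc allN cov ov nb with coveredᵇ-elim (suc n') (x ∷ S') cov 0
  (s≤s z≤n) | coveredᵇ-elim (suc n') (x ∷ S') cov n' ≤-refl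
... | i , m , i≤0 , _ | i' , m' , i'≤ , n'< = gaps , antisym
  where
  x≡0 : x ≡ 0
  x≡0 = n≤0⇒n≡0 (≤-trans (Inc-head≤ 0 x S' inc m) i≤0)
  gaps : Chain 0 (x ∷ S')
  gaps = subst (λ z → Chain z (x ∷ S')) x≡0 (Chain-fromConditions 0 x S' inc ov nb)
  lo : suc n' ∸ 5 ≤ i'
  lo = ∸-monoˡ-≤ 4 (≤-pred (subst (n' <_) (+-comm i' 5) n'<))
  i'≤last : i' ≤ lastL (x ∷ S')
  i'≤last = All.lookup (Inc-last 0 (x ∷ S') inc) m'
  last≤ : lastL (x ∷ S') ≤ suc n' ∸ 5
  last≤ = ≤-pred (All.lookup allN (lastL∈ x S'))
  antisym : lastL (x ∷ S') ≡ suc n' ∸ 5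
  antisym = ≤-antisym last≤ (≤-trans lo i'≤last)

markings⇒Chain : ∀ n k S → 5 ≤ n → S ∈ markings n k → Chain 0 S × lastL S ≡ n ∸ 5 × length S ≡ k
markings⇒Chain n k S 5≤n m with ∈-filterᵇ⁻ _ (sublists (upTo (suc (n ∸ 5)))) m
... | mS , e with ∧-elim {markingᵇ n k S} e
... | cmt , nbt with ∧-elim {length S ≡ᵇ k} cmt
... | lent , covov with ∧-elim {coveredᵇ 5 n S} covov
... | cov , ov with ∈sublists-range⇒ 0 (suc (n ∸ 5)) S (subst (λ z → S ∈ sublists z) (upTo-rng (suc (n ∸ 5))) mS)
... | inc , allN with markingConditions⇒Chain n S 5≤n inc allN cov ov nbt
... | g , l = g , l , ≡ᵇ≡true⇒≡ lent

Chain⇒markings : ∀ n k S → 5 ≤ n → Chain 0 S → lastL S ≡ n ∸ 5 → length S ≡ k → S ∈ markings n k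
Chain⇒markings n k S 5≤n g l len =
  ∈-filterᵇ⁺ (λ S → markingᵇ n k S ∧ noShift13ᵇ S) (sublists (upTo (suc (n ∸ 5))))
    (subst (λ z → S ∈ sublists z) (sym (upTo-rng (suc (n ∸ 5)))) (∈sublists-range⇐ 0 (suc (n ∸ 5)) S (Chain-Inc g) allN))
    (∧-intro (∧-intro (subst (λ z → (length S ≡ᵇ z) ≡ true) len (≡ᵇ-refl (length S)))
                      (∧-intro cov (Chain-overlap g)))
             (Chain-noShift13 g))
  where
  allN : All (_< 0 + suc (n ∸ 5)) S
  allN = All.map (λ {x} le → s≤s (subst (x ≤_) l le)) (Inc-last 0 S (Chain-Inc g))
  cov : coveredᵇ 5 n S ≡ true
  cov = all-intro _ (upTo n) (λ {j} mj →
    Chain-covers g j z≤n (subst (j <_) (sym (trans (cong (_+ 5) l) (m∸n+n≡m 5≤n))) (∈-upTo⁻ mj)))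

HeadMin-Chain : ∀ {a S} τ → Chain a S → lastL S + 5 ≡ length τ → all (occ τ) S ≡ true → HeadMin (drop a τ)
HeadMin-Chain τ (single a) len h = HeadMin-single (drop a τ) (occursAt⇒Occ τ a (proj₁ (∧-elim {occ τ a} h)))
  (trans (length-drop a τ) (trans (cong (_∸ a) (sym len)) (m+n∸m≡n a 5)))
HeadMin-Chain τ (step2 a S g) len h =
  HeadMin-step2 (drop a τ) (occursAt⇒Occ τ a (proj₁ (∧-elim {occ τ a} h)))
    (subst HeadMin (drop-comm 2 a τ) (HeadMin-Chain τ g (trans (cong (_+ 5) (sym (lastL-cons a S (Chain-nonempty g)))) len) (proj₂ (∧-elim {occ τ a} h))))
HeadMin-Chain τ (step4 a S g) len h =
  HeadMin-step4 (drop a τ) (occursAt⇒Occ τ a (proj₁ (∧-elim {occ τ a} h)))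
    (subst HeadMin (drop-comm 4 a τ) (HeadMin-Chain τ g (trans (cong (_+ 5) (sym (lastL-cons a S (Chain-nonempty g)))) len) (proj₂ (∧-elim {occ τ a} h))))

headMin-markings : ∀ m k' S' τ → 5 ≤ m → S' ∈ markings m k' → length τ ≡ m → all (occ τ) S' ≡ true → headMinᵇ τ ≡ true
headMin-markings m k' S' τ 5≤m mem len h with markings⇒Chain m k' S' 5≤m mem
... | g , l , _ = HeadMin⇒headMinᵇ τ (HeadMin-Chain τ g (trans (cong (_+ 5) l) (trans (m∸n+n≡m 5≤m) (sym len))) h)

run-offset-step : ∀ a ℓ → (2 + a) + (2 * ℓ + 2) ≡ a + (2 * suc ℓ + 2)
run-offset-step = solve-∀

map-shift-2 : ∀ a (R : List ℕ) → map (a +_) (map (2 +_) R) ≡ map ((2 + a) +_) R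
map-shift-2 a R = trans (map-shift a 2 R) (cong (λ z → map (z +_) R) (+-comm a 2))

subst-optionalChain : ∀ {T x y} → (T ≡ [] ⊎ Chain x T) → x ≡ y → (T ≡ [] ⊎ Chain y T)
subst-optionalChain (inj₁ e) _ = inj₁ e
subst-optionalChain (inj₂ g) refl = inj₂ g

Chain-initialRun : ∀ {a S} → Chain a S → ∃ λ ℓ → ∃ λ T →
  (1 ≤ ℓ) × (S ≡ map (a +_) (run ℓ) ++ T) × (T ≡ [] ⊎ Chain (a + (2 * ℓ + 2)) T)
Chain-initialRun (single a) = 1 , [] , s≤s z≤n , cong (_∷ []) (sym (+-identityʳ a)) , inj₁ refl
Chain-initialRun (step4 a S g) = 1 , S , s≤s z≤n , cong (_∷ S) (sym (+-identityʳ a)) , inj₂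
  (subst (λ z → Chain z S) (+-comm 4 a) g)
Chain-initialRun (step2 a S g) with Chain-initialRun g
... | ℓ , T , 1≤ℓ , eq , rest = suc ℓ , T , s≤s z≤n , cong₂ _∷_ (sym (+-identityʳ a))
  (trans eq (cong (_++ T) (sym (map-shift-2 a (run ℓ))))) , rest'
  where
  rest' : T ≡ [] ⊎ Chain (a + (2 * suc ℓ + 2)) T
  rest' = subst-optionalChain rest (run-offset-step a ℓ)

Chain-prependRun : ∀ a ℓ T → 1 ≤ ℓ → (T ≡ [] ⊎ Chain (a + (2 * ℓ + 2)) T) → Chain a (map (a +_) (run ℓ) ++ T)
Chain-prependRun a (suc zero) .[] _ (inj₁ refl) = subst (λ z → Chain a (z ∷ [])) (sym (+-identityʳ a)) (single a)
Chain-prependRun a (suc zero) T _ (inj₂ g) = subst (λ z → Chain a (z ∷ T)) (sym (+-identityʳ a))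
  (step4 a T (subst (λ z → Chain z T) (+-comm a 4) g))
Chain-prependRun a (suc (suc ℓ)) T _ r =
  subst (λ z → Chain a (z ∷ (map (a +_) (map (2 +_) (run (suc ℓ))) ++ T))) (sym (+-identityʳ a))
    (step2 a _ (subst (λ z → Chain (2 + a) (z ++ T)) (sym (map-shift-2 a (run (suc ℓ)))) (Chain-prependRun (2 + a) (suc ℓ) T (s≤s z≤n) r')))
  where
  r' : T ≡ [] ⊎ Chain ((2 + a) + (2 * suc ℓ + 2)) T
  r' = subst-optionalChain r (sym (run-offset-step a (suc ℓ)))

-- 'markings′' extends 'markings' by the paper's initial condition s_{1,0} = 1:
-- the only marking of length 1 is empty.  'runDecomposition n k' lists
-- 'prependRun ℓ S′' for admissible ℓ and S′ ∈ markings′ (n-2ℓ-2) (k-ℓ).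
admissible : ℕ → ℕ → ℕ → Bool
admissible n k ℓ = (5 ≤ᵇ 2 * ℓ + 3) ∧ (2 * ℓ + 3 ≤ᵇ n) ∧ (ℓ ≤ᵇ k)

admissible-positive : ∀ ℓ → (5 ≤ᵇ 2 * ℓ + 3) ≡ true → 1 ≤ ℓ
admissible-positive zero ()
admissible-positive (suc ℓ) _ = s≤s z≤n

admissible⇒ : ∀ n k ℓ → admissible n k ℓ ≡ true → (1 ≤ ℓ) × (2 * ℓ + 3 ≤ n) × (ℓ ≤ k)
admissible⇒ n k ℓ e with ∧-elim {5 ≤ᵇ 2 * ℓ + 3} e
... | e1 , e23 with ∧-elim {2 * ℓ + 3 ≤ᵇ n} e23
... | e2 , e3 = admissible-positive ℓ e1 , ≤ᵇ≡true⇒≤ e2 , ≤ᵇ≡true⇒≤ e3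

⇒admissible : ∀ n k ℓ → 1 ≤ ℓ → 2 * ℓ + 3 ≤ n → ℓ ≤ k → admissible n k ℓ ≡ true
⇒admissible n k ℓ a b c = ∧-intro (≤⇒≤ᵇ≡true (+-monoˡ-≤ 3 (*-monoʳ-≤ 2 a))) (∧-intro (≤⇒≤ᵇ≡true b) (≤⇒≤ᵇ≡true c))

markings′ : ℕ → ℕ → List (List ℕ)
markings′ m k = if m <ᵇ 5 then (if (m ≡ᵇ 1) ∧ (k ≡ᵇ 0) then [] ∷ [] else []) else markings m k

markings′⁻ : ∀ m k S' → S' ∈ markings′ m k → ((m ≡ 1) × (k ≡ 0) × (S' ≡ [])) ⊎ ((5 ≤ m) × (S' ∈ markings m k))
markings′⁻ m k S' mem with m <ᵇ 5 in e
... | false = inj₂ (≮ᵇ⇒≤ e , mem)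
... | true with (m ≡ᵇ 1) ∧ (k ≡ᵇ 0) in e2
markings′⁻ m k S' (here refl) | true | true with ∧-elim {m ≡ᵇ 1} e2
... | a , b = inj₁ (≡ᵇ≡true⇒≡ a , ≡ᵇ≡true⇒≡ b , refl)
markings′⁻ m k S' () | true | false

markings′⁺ : ∀ m k S' → 5 ≤ m → S' ∈ markings m k → S' ∈ markings′ m k
markings′⁺ m k S' le mem rewrite ≤⇒≮ᵇ le = mem

prependRun : ℕ → List ℕ → List ℕ
prependRun ℓ S' = run ℓ ++ map ((2 * ℓ + 2) +_) S'

admissibleLengths : ℕ → ℕ → List ℕ
admissibleLengths n k = filterᵇ (admissible n k) (upTo (suc n))

∈admissibleLengths⇒ : ∀ n k ℓ → ℓ ∈ admissibleLengths n k → (1 ≤ ℓ) × (2 * ℓ + 3 ≤ n) × (ℓ ≤ k)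
∈admissibleLengths⇒ n k ℓ m = admissible⇒ n k ℓ (proj₂ (∈-filterᵇ⁻ (admissible n k) (upTo (suc n)) m))

withInitialRun : ℕ → ℕ → ℕ → List (List ℕ)
withInitialRun n k ℓ = map (prependRun ℓ) (markings′ (n ∸ 2 * ℓ ∸ 2) (k ∸ ℓ))

runDecomposition : ℕ → ℕ → List (List ℕ)
runDecomposition n k = concatMap (withInitialRun n k) (admissibleLengths n k)

lastL-run : ∀ ℓ → lastL (run (suc ℓ)) ≡ 2 * ℓ
lastL-run zero = refl
lastL-run (suc ℓ) = trans (lastL-cons 0 (map (2 +_) (run (suc ℓ)))
  (subst (0 <_) (sym (length-map (2 +_) (run (suc ℓ)))) (s≤s z≤n)))
                   (trans (lastL-map 2 (run (suc ℓ)) (s≤s z≤n)) (trans (cong (2 +_) (lastL-run ℓ)) (sym (*-distribˡ-+ 2 1 ℓ))))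

n≡2ℓ+2+rest : ∀ n ℓ → 2 * ℓ + 2 ≤ n → n ≡ (2 * ℓ + 2) + (n ∸ 2 * ℓ ∸ 2)
n≡2ℓ+2+rest n ℓ le = trans (sym (m+[n∸m]≡n le)) (cong ((2 * ℓ + 2) +_) (sym (∸-+-assoc n (2 * ℓ) 2)))

rest≡ : ∀ n ℓ x → n ≡ (2 * ℓ + 2) + x → n ∸ 2 * ℓ ∸ 2 ≡ x
rest≡ n ℓ x e = trans (∸-+-assoc n (2 * ℓ) 2) (trans (cong (_∸ (2 * ℓ + 2)) e) (m+n∸m≡n (2 * ℓ + 2) x))

n≡[n∸5]+5 : ∀ n → 5 ≤ n → n ≡ (n ∸ 5) + 5
n≡[n∸5]+5 n le = sym (m∸n+n≡m le)

ℓ+[ℓ+0+3]≡2ℓ+3 : ∀ ℓ → ℓ + (ℓ + 0 + 3) ≡ 2 * ℓ + 3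
ℓ+[ℓ+0+3]≡2ℓ+3 = solve-∀

2[1+ℓ]+3≡2ℓ+5 : ∀ ℓ₀ → 2 * suc ℓ₀ + 3 ≡ 2 * ℓ₀ + 5
2[1+ℓ]+3≡2ℓ+5 = solve-∀

2ℓ+3≡[2ℓ+2]+1 : ∀ ℓ → 2 * ℓ + 3 ≡ (2 * ℓ + 2) + 1
2ℓ+3≡[2ℓ+2]+1 = solve-∀

2ℓ+2≤n : ∀ n ℓ → 2 * ℓ + 3 ≤ n → 2 * ℓ + 2 ≤ n
2ℓ+2≤n n ℓ b = ≤-trans (m≤m+n (2 * ℓ + 2) 1) (≤-trans (≤-reflexive (sym (2ℓ+3≡[2ℓ+2]+1 ℓ))) b)

suffix-length-arith₀ : ∀ ℓ mL → suc ((2 * ℓ + 2) + mL) ≡ ℓ + ((suc ℓ + mL) + 2)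
suffix-length-arith₀ = solve-∀

suffix-length-arith : ∀ ℓ mL → suc ((2 * ℓ + 2) + mL) ∸ ℓ ∸ 2 ≡ suc ℓ + mL
suffix-length-arith ℓ mL = trans (cong (λ z → z ∸ ℓ ∸ 2) (suffix-length-arith₀ ℓ mL))
  (trans (cong (_∸ 2) (m+n∸m≡n ℓ ((suc ℓ + mL) + 2))) (m+n∸n≡m (suc ℓ + mL) 2))

prependRun∈runDecomposition : ∀ n k ℓ S' → 1 ≤ ℓ → 2 * ℓ + 3 ≤ n → ℓ ≤ k →
  S' ∈ markings′ (n ∸ 2 * ℓ ∸ 2) (k ∸ ℓ) → prependRun ℓ S' ∈ runDecomposition n k
prependRun∈runDecomposition n k ℓ S' a b c m = ∈-concatMap⁺ (withInitialRun n k) (admissibleLengths n k)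
      (∈-filterᵇ⁺ (admissible n k) (upTo (suc n)) (∈-upTo⁺ (s≤s (≤-trans (≤-trans (m≤m+n ℓ (ℓ + 0 + 3)) (≤-reflexive (ℓ+[ℓ+0+3]≡2ℓ+3 ℓ))) b))) (⇒admissible n k ℓ a b c))
      (∈-map⁺ (prependRun ℓ) m)

markings⇒runDecomposition-end : ∀ n k ℓ → 5 ≤ n → 1 ≤ ℓ → lastL (run ℓ) ≡ n ∸ 5 → length (run ℓ) ≡ k →
  prependRun ℓ [] ∈ runDecomposition n k
markings⇒runDecomposition-end n k (suc ℓ₀) 5≤n _ l len = prependRun∈runDecomposition n k (suc ℓ₀) []
  (s≤s z≤n) (≤-reflexive (sym nE)) kle mem
  where
  nE : n ≡ 2 * suc ℓ₀ + 3
  nE = trans (n≡[n∸5]+5 n 5≤n) (trans (cong (_+ 5) (sym (trans (sym (lastL-run ℓ₀)) l)))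
    (sym (2[1+ℓ]+3≡2ℓ+5 ℓ₀)))
  kE : k ≡ suc ℓ₀
  kE = trans (sym len) (length-run (suc ℓ₀))
  kle : suc ℓ₀ ≤ k
  kle = ≤-reflexive (sym kE)
  mem : [] ∈ markings′ (n ∸ 2 * suc ℓ₀ ∸ 2) (k ∸ suc ℓ₀)
  mem rewrite rest≡ n (suc ℓ₀) 1 (trans nE (2ℓ+3≡[2ℓ+2]+1 (suc ℓ₀))) | kE | n∸n≡0 ℓ₀ = here refl

markings⇒runDecomposition-mid : ∀ n k ℓ S' → 5 ≤ n → 1 ≤ ℓ → Chain 0 S' → lastL (prependRun ℓ S') ≡ n ∸ 5 →
  length (prependRun ℓ S') ≡ k → prependRun ℓ S' ∈ runDecomposition n k
markings⇒runDecomposition-mid n k ℓ S' 5≤n 1≤ℓ g' l len = prependRun∈runDecomposition n k ℓ S' 1≤ℓ b c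
  (markings′⁺ m (k ∸ ℓ) S' 5≤m (Chain⇒markings m (k ∸ ℓ) S' 5≤m g' lastEq lenEq))
  where
  p = 2 * ℓ + 2
  Ls = lastL S'
  ne : 0 < length (map (p +_) S')
  ne = subst (0 <_) (sym (length-map (p +_) S')) (Chain-nonempty g')
  lE : n ∸ 5 ≡ p + Ls
  lE = trans (sym l) (trans (lastL-++ (run ℓ) (map (p +_) S') ne) (lastL-map p S' (Chain-nonempty g')))
  nE : n ≡ p + (Ls + 5)
  nE = trans (n≡[n∸5]+5 n 5≤n) (trans (cong (_+ 5) lE) (+-assoc p Ls 5))
  m = n ∸ 2 * ℓ ∸ 2
  mE : m ≡ Ls + 5
  mE = rest≡ n ℓ (Ls + 5) nE
  5≤m : 5 ≤ m
  5≤m = subst (5 ≤_) (sym mE) (m≤n+m 5 Ls)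
  lastEq : lastL S' ≡ m ∸ 5
  lastEq = sym (trans (cong (_∸ 5) mE) (m+n∸n≡m Ls 5))
  lenS : ℓ + length S' ≡ k
  lenS = trans (cong₂ _+_ (sym (length-run ℓ)) (sym (length-map (p +_) S'))) (trans (sym (length-++ (run ℓ))) len)
  c : ℓ ≤ k
  c = subst (ℓ ≤_) lenS (m≤m+n ℓ (length S'))
  lenEq : length S' ≡ k ∸ ℓ
  lenEq = sym (trans (cong (_∸ ℓ) (sym lenS)) (m+n∸m≡n ℓ (length S')))
  b : 2 * ℓ + 3 ≤ n
  b = subst (2 * ℓ + 3 ≤_) (sym nE)
    (≤-trans (≤-reflexive (2ℓ+3≡[2ℓ+2]+1 ℓ)) (+-monoʳ-≤ p (≤-trans (s≤s z≤n) (m≤n+m 5 Ls))))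

markings⇒runDecomposition : ∀ n k S → 5 ≤ n → S ∈ markings n k → S ∈ runDecomposition n k
markings⇒runDecomposition n k S 5≤n mem with markings⇒Chain n k S 5≤n mem
... | g , l , len with Chain-initialRun g
... | ℓ , T , 1≤ℓ , eq , inj₁ refl =
  subst (_∈ runDecomposition n k) (sym S≡)
    (markings⇒runDecomposition-end n k ℓ 5≤n 1≤ℓ (trans (sym (cong lastL S≡')) l) (trans (sym (cong length S≡')) len))
  where
  S≡' : S ≡ run ℓ
  S≡' = trans eq (trans (cong (_++ []) (map-id (run ℓ))) (++-identityʳ (run ℓ)))
  S≡ : S ≡ prependRun ℓ []
  S≡ = trans S≡' (sym (++-identityʳ (run ℓ)))
... | ℓ , T , 1≤ℓ , eq , inj₂ gT with Chain-shiftDown gT (2 * ℓ + 2) 0 (sym (+-identityʳ _))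
... | S' , eT , g' = subst (_∈ runDecomposition n k) (sym S≡)
  (markings⇒runDecomposition-mid n k ℓ S' 5≤n 1≤ℓ g' (trans (sym (cong lastL S≡)) l) (trans (sym (cong length S≡)) len))
  where
  S≡ : S ≡ prependRun ℓ S'
  S≡ = trans eq (trans (cong (_++ T) (map-id (run ℓ))) (cong (run ℓ ++_) eT))

runDecomposition⇒markings-end : ∀ n k ℓ → 5 ≤ n → 1 ≤ ℓ → ℓ ≤ k → 2 * ℓ + 3 ≤ n → n ∸ 2 * ℓ ∸ 2 ≡ 1 → k ∸ ℓ ≡
  0 → prependRun ℓ [] ∈ markings n k
runDecomposition⇒markings-end n k (suc ℓ₀) 5≤n _ c b m1 k0 = Chain⇒markings n k (prependRun (suc ℓ₀) []) 5≤n
  gaps last len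
  where
  ℓ = suc ℓ₀
  le22 : 2 * ℓ + 2 ≤ n
  le22 = 2ℓ+2≤n n ℓ b
  nE : n ≡ 2 * ℓ₀ + 5
  nE = trans (n≡2ℓ+2+rest n ℓ le22)
    (trans (cong ((2 * ℓ + 2) +_) m1) (trans (sym (2ℓ+3≡[2ℓ+2]+1 (suc ℓ₀))) (2[1+ℓ]+3≡2ℓ+5 ℓ₀)))
  gaps : Chain 0 (prependRun ℓ [])
  gaps = subst (λ z → Chain 0 (z ++ [])) (map-id (run ℓ)) (Chain-prependRun 0 ℓ [] (s≤s z≤n) (inj₁ refl))
  last : lastL (prependRun ℓ []) ≡ n ∸ 5
  last = trans (cong lastL (++-identityʳ (run ℓ)))
    (trans (lastL-run ℓ₀) (sym (trans (cong (_∸ 5) nE) (m+n∸n≡m (2 * ℓ₀) 5))))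
  len : length (prependRun ℓ []) ≡ k
  len = trans (cong length (++-identityʳ (run ℓ))) (trans (length-run ℓ) (≤-antisym c (m∸n≡0⇒m≤n k0)))

runDecomposition⇒markings-mid : ∀ n k ℓ S' → 5 ≤ n → 1 ≤ ℓ → ℓ ≤ k → 2 * ℓ + 3 ≤ n → 5 ≤ (n ∸ 2 * ℓ ∸ 2) →
  S' ∈ markings (n ∸ 2 * ℓ ∸ 2) (k ∸ ℓ) → prependRun ℓ S' ∈ markings n k
runDecomposition⇒markings-mid n k ℓ S' 5≤n 1≤ℓ c b 5≤m mV with markings⇒Chain (n ∸ 2 * ℓ ∸ 2) (k ∸ ℓ) S' 5≤m mV
... | g' , l' , len' = Chain⇒markings n k (prependRun ℓ S') 5≤n gaps last len
  where
  p = 2 * ℓ + 2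
  m = n ∸ 2 * ℓ ∸ 2
  le22 : p ≤ n
  le22 = 2ℓ+2≤n n ℓ b
  gaps : Chain 0 (prependRun ℓ S')
  gaps = subst (λ z → Chain 0 (z ++ map (p +_) S')) (map-id (run ℓ))
           (Chain-prependRun 0 ℓ (map (p +_) S') 1≤ℓ (inj₂ (subst (λ z → Chain z (map (p +_) S')) (+-identityʳ p) (Chain-shiftUp p g'))))
  ne : 0 < length (map (p +_) S')
  ne = subst (0 <_) (sym (length-map (p +_) S')) (Chain-nonempty g')
  last : lastL (prependRun ℓ S') ≡ n ∸ 5
  last = trans (lastL-++ (run ℓ) (map (p +_) S') ne) (trans (lastL-map p S' (Chain-nonempty g'))
           (trans (cong (p +_) l') (sym (trans (cong (_∸ 5) (n≡2ℓ+2+rest n ℓ le22)) (+-∸-assoc p 5≤m)))))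
  len : length (prependRun ℓ S') ≡ k
  len = trans (length-++ (run ℓ)) (trans (cong₂ _+_ (length-run ℓ) (trans (length-map (p +_) S') len')) (m+[n∸m]≡n c))

runDecomposition⇒markings : ∀ n k S → 5 ≤ n → S ∈ runDecomposition n k → S ∈ markings n k
runDecomposition⇒markings n k S 5≤n mem with ∈-concatMap⁻ (withInitialRun n k) (admissibleLengths n k) mem
... | ℓ , mℓ , mS with ∈-map⁻ (prependRun ℓ) mS
... | S' , mS' , refl with ∈admissibleLengths⇒ n k ℓ mℓ
... | 1≤ℓ , b , c with markings′⁻ (n ∸ 2 * ℓ ∸ 2) (k ∸ ℓ) S' mS'
... | inj₁ (m≡1 , k'≡0 , refl) = runDecomposition⇒markings-end n k ℓ 5≤n 1≤ℓ c b m≡1 k'≡0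
... | inj₂ (5≤m , mV) = runDecomposition⇒markings-mid n k ℓ S' 5≤n 1≤ℓ c b 5≤m mV

-- Both lists are duplicate-free: the length of the initial run recovers ℓ.
Unique-markings : ∀ n k → Unique (markings n k)
Unique-markings n k = Unique-filterᵇ _
  (subst Unique (sym (cong sublists (upTo-rng (suc (n ∸ 5))))) (Unique-sublists-range 0 (suc (n ∸ 5))))

Unique-markings′ : ∀ m k → Unique (markings′ m k)
Unique-markings′ m k with m <ᵇ 5
... | false = Unique-markings m k
... | true with (m ≡ᵇ 1) ∧ (k ≡ᵇ 0)
... | true = [] ∷ []
... | false = []

prependRun-injective : ∀ ℓ {x y} → prependRun ℓ x ≡ prependRun ℓ y → x ≡ y
prependRun-injective ℓ {x} {y} e = map-injective (λ {a} {b} → +-cancelˡ-≡ (2 * ℓ + 2) a b) (++-cancelˡ (run ℓ) _ _ e)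

initialRunLength : List ℕ → ℕ
initialRunLength [] = 0
initialRunLength (x ∷ []) = 1
initialRunLength (x ∷ y ∷ r) = if y ≡ᵇ 2 + x then suc (initialRunLength (y ∷ r)) else 1

HeadIs : ℕ → List ℕ → Set
HeadIs c [] = ⊤
HeadIs c (x ∷ _) = x ≡ c

4≢2 : 4 ≢ 2
4≢2 ()

initialRunLength-shifted : ∀ c ℓ T → HeadIs (c + (2 * suc ℓ + 2)) T →
  initialRunLength (map (c +_) (run (suc ℓ)) ++ T) ≡ suc ℓ
initialRunLength-shifted c zero [] _ = refl
initialRunLength-shifted c zero (t ∷ T) refl rewrite ≡ᵇ-≢ (c + 4) (2 + (c + 0))
  (λ e → 4≢2 (+-cancelˡ-≡ c 4 2 (trans e (trans (cong (2 +_) (+-identityʳ c)) (+-comm 2 c))))) = refl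
initialRunLength-shifted c (suc ℓ) T h = trans
  (cong (λ z → initialRunLength ((c + 0) ∷ (z ++ T))) (map-shift-2 c (run (suc ℓ)))) step
  where
  step : initialRunLength ((c + 0) ∷ (map ((2 + c) +_) (run (suc ℓ)) ++ T)) ≡ suc (suc ℓ)
  step rewrite ≡ᵇ-refl (2 + (c + 0)) = cong suc
    (initialRunLength-shifted (2 + c) ℓ T (subst (λ z → HeadIs z T) (sym (run-offset-step c (suc ℓ))) h))

initialRunLength-prependRun : ∀ ℓ S' → 1 ≤ ℓ → (S' ≡ [] ⊎ Chain 0 S') → initialRunLength (prependRun ℓ S') ≡ ℓ
initialRunLength-prependRun (suc ℓ₀) S' _ h = trans
  (cong (λ z → initialRunLength (z ++ map ((2 * suc ℓ₀ + 2) +_) S')) (sym (map-id (run (suc ℓ₀)))))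
  (initialRunLength-shifted 0 ℓ₀ _ (hd h))
  where
  hd : (S' ≡ [] ⊎ Chain 0 S') → HeadIs (2 * suc ℓ₀ + 2) (map ((2 * suc ℓ₀ + 2) +_) S')
  hd (inj₁ refl) = tt
  hd (inj₂ g) with Chain-cons g
  ... | r , refl = +-identityʳ _

runDecomposition-parts : ∀ ℓ m k' b → b ∈ map (prependRun ℓ) (markings′ m k') → ∃ λ S' →
  (b ≡ prependRun ℓ S') × (S' ≡ [] ⊎ Chain 0 S')
runDecomposition-parts ℓ m k' b mem with ∈-map⁻ (prependRun ℓ) mem
... | S' , mS' , eq with markings′⁻ m k' S' mS'
... | inj₁ (_ , _ , e) = S' , eq , inj₁ e
... | inj₂ (5≤m , mV) = S' , eq , inj₂ (proj₁ (markings⇒Chain m k' S' 5≤m mV))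

Unique-runDecomposition : ∀ n k → Unique (runDecomposition n k)
Unique-runDecomposition n k = Unique-concatMap (withInitialRun n k) (admissibleLengths n k)
  (Unique-filterᵇ (admissible n k) (Unique.upTo⁺ (suc n)))
    (λ ℓ _ → Unique.map⁺ (prependRun-injective ℓ) (Unique-markings′ (n ∸ 2 * ℓ ∸ 2) (k ∸ ℓ))) disj
  where
  disj : ∀ {ℓ ℓ' b} → ℓ ∈ admissibleLengths n k → ℓ' ∈ admissibleLengths n k →
         b ∈ map (prependRun ℓ) (markings′ (n ∸ 2 * ℓ ∸ 2) (k ∸ ℓ)) → b ∈ map (prependRun ℓ') (markings′ (n ∸ 2 * ℓ' ∸ 2) (k ∸ ℓ')) → ℓ ≡ ℓ'
  disj {ℓ} {ℓ'} {b} m1 m2 b1 b2 with runDecomposition-parts ℓ (n ∸ 2 * ℓ ∸ 2) (k ∸ ℓ) b b1 |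
    runDecomposition-parts ℓ' (n ∸ 2 * ℓ' ∸ 2) (k ∸ ℓ') b b2
  ... | S1 , e1 , h1 | S2 , e2 , h2 =
    trans (sym (initialRunLength-prependRun ℓ S1 (proj₁ (∈admissibleLengths⇒ n k ℓ m1)) h1))
          (trans (cong initialRunLength (trans (sym e1) e2)) (initialRunLength-prependRun ℓ' S2 (proj₁ (∈admissibleLengths⇒ n k ℓ' m2)) h2))

sumL-markings≡runDecomposition : ∀ n k (g : List ℕ → ℕ) → 5 ≤ n → sumL g (markings n k) ≡ sumL g (runDecomposition n k)
sumL-markings≡runDecomposition n k g 5≤n = sum-uniq g (markings n k) (runDecomposition n k)
  (Unique-markings n k) (Unique-runDecomposition n k) (λ {S} m → markings⇒runDecomposition n k S 5≤n m)
  (λ {S} m → runDecomposition⇒markings n k S 5≤n m)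

compatible : ℕ → List ℕ → ℕ
compatible n S = sumL (λ π → b2n (all (occ π) S)) (Perm n)

candidates : ℕ → List (List ℕ)
candidates n = sublists (upTo (suc (n ∸ 5)))

sublists-filterᵇ : ∀ (q : ℕ → Bool) xs → sublists (filterᵇ q xs) ≡ filterᵇ (all q) (sublists xs)
sublists-filterᵇ q [] = refl
sublists-filterᵇ q (x ∷ xs) with q x in e
... | true =
  begin
    map (x ∷_) (sublists (filterᵇ q xs)) ++ sublists (filterᵇ q xs)
  ≡⟨ cong (λ z → map (x ∷_) z ++ z) (sublists-filterᵇ q xs) ⟩
    map (x ∷_) (filterᵇ (all q) (sublists xs)) ++ filterᵇ (all q) (sublists xs)
  ≡⟨ cong (_++ filterᵇ (all q) (sublists xs)) (sym (keep (sublists xs))) ⟩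
    filterᵇ (all q) (map (x ∷_) (sublists xs)) ++ filterᵇ (all q) (sublists xs)
  ≡⟨ sym (filter-++ (T? ∘ all q) (map (x ∷_) (sublists xs)) (sublists xs)) ⟩
    filterᵇ (all q) (map (x ∷_) (sublists xs) ++ sublists xs)
  ∎
  where
  open ≡-Reasoning
  keep : ∀ ys → filterᵇ (all q) (map (x ∷_) ys) ≡ map (x ∷_) (filterᵇ (all q) ys)
  keep [] = refl
  keep (y ∷ ys) rewrite e with all q y
  ... | true = cong ((x ∷ y) ∷_) (keep ys)
  ... | false = keep ys
... | false =
  begin
    sublists (filterᵇ q xs)
  ≡⟨ sublists-filterᵇ q xs ⟩
    filterᵇ (all q) (sublists xs)
  ≡⟨ cong (_++ filterᵇ (all q) (sublists xs)) (sym (reject (sublists xs))) ⟩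
    filterᵇ (all q) (map (x ∷_) (sublists xs)) ++ filterᵇ (all q) (sublists xs)
  ≡⟨ sym (filter-++ (T? ∘ all q) (map (x ∷_) (sublists xs)) (sublists xs)) ⟩
    filterᵇ (all q) (map (x ∷_) (sublists xs) ++ sublists xs)
  ∎
  where
  open ≡-Reasoning
  reject : ∀ ys → filterᵇ (all q) (map (x ∷_) ys) ≡ []
  reject [] = refl
  reject (y ∷ ys) rewrite e = reject ys

markingCount-filter : ∀ k π n → length
  (filterᵇ (markingᵇ n k) (sublists (filterᵇ (occ π) (upTo (suc (n ∸ 5)))))) ≡
  sumL (λ S → b2n (all (occ π) S) * b2n (markingᵇ n k S)) (candidates n)
markingCount-filter k π n = trans
  (cong (λ z → length (filterᵇ (markingᵇ n k) z)) (sublists-filterᵇ (occ π) (upTo (suc (n ∸ 5)))))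
           (trans (length-filterᵇ (markingᵇ n k) (filterᵇ (all (occ π)) (candidates n))) (sumL-filterᵇ (λ S → b2n (markingᵇ n k S)) (all (occ π)) (candidates n)))

markingCount : ∀ n k π → length π ≡ n →
  length (filterᵇ (isClusterMarkingᵇ σ₁₅₂₄₃ k π) (sublists (occurrences σ₁₅₂₄₃ π))) ≡
    sumL (λ S → b2n (all (occ π) S) * b2n (markingᵇ n k S)) (candidates n)
markingCount n k π e = trans (cong
  (λ m → length (filterᵇ (markingᵇ m k) (sublists (filterᵇ (occ π) (upTo (suc (m ∸ 5))))))) e)
  (markingCount-filter k π n)

compatible-pointwise : ∀ n k S → b2n (markingᵇ n k S ∧ noShift13ᵇ S) * compatible n S ≡
  sumL (λ π → b2n (all (occ π) S) * b2n (markingᵇ n k S)) (Perm n)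
compatible-pointwise n k S with noShift13ᵇ S in e
... | true = trans (cong (_* compatible n S) (trans (b2n-∧ (markingᵇ n k S) true) (*-identityʳ (b2n (markingᵇ n k S)))))
             (trans (sumL-*ˡ (b2n (markingᵇ n k S)) (λ π → b2n (all (occ π) S)) (Perm n)) (sumL-cong (λ π → *-comm (b2n (markingᵇ n k S)) _) (Perm n)))
... | false = trans (cong (_* compatible n S)
  (trans (b2n-∧ (markingᵇ n k S) false) (*-zeroʳ (b2n (markingᵇ n k S))))) (sym (sumL-0 (Perm n) pt))
  where
  pt : ∀ π → b2n (all (occ π) S) * b2n (markingᵇ n k S) ≡ 0
  pt π with all (occ π) S in e2
  ... | false = refl
  ... | true = ⊥-elim (true≢false (trans (sym (occurrences-noShift13 π S e2)) e))

s≡sumL-compatible : ∀ n k → 5 ≤ n → sumL (compatible n) (markings n k) ≡ s n k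
s≡sumL-compatible n k 5≤n rewrite ≤⇒≮ᵇ 5≤n =
  begin
    sumL (compatible n) (markings n k)
  ≡⟨ sumL-filterᵇ (compatible n) (λ S → markingᵇ n k S ∧ noShift13ᵇ S) (candidates n) ⟩
    sumL (λ S → b2n (markingᵇ n k S ∧ noShift13ᵇ S) * compatible n S) (candidates n)
  ≡⟨ sumL-cong (compatible-pointwise n k) (candidates n) ⟩
    sumL (λ S → sumL (λ π → marked π S) (Perm n)) (candidates n)
  ≡⟨ sym (sumL-swap marked (Perm n) (candidates n)) ⟩
    sumL (λ π → sumL (marked π) (candidates n)) (Perm n)
  ≡⟨ sym (sumL-congP {P = PermShape n} (λ π (len , _) → markingCount n k π len) (Perm-shape n)) ⟩
    sumL clustersOn (Perm n)
  ≡⟨ sym (sumL-perms≡Perm n clustersOn) ⟩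
    sumL clustersOn (perms n)
  ≡⟨ sym (sum-map clustersOn (perms n)) ⟩
    clusterCount σ₁₅₂₄₃ n k
  ∎
  where
  open ≡-Reasoning
  marked : List ℕ → List ℕ → ℕ
  marked π S = b2n (all (occ π) S) * b2n (markingᵇ n k S)
  clustersOn : List ℕ → ℕ
  clustersOn π = length (filterᵇ (isClusterMarkingᵇ σ₁₅₂₄₃ k π) (sublists (occurrences σ₁₅₂₄₃ π)))

s-large : ∀ m k → (m <ᵇ 5) ≡ false → s m k ≡ clusterCount σ₁₅₂₄₃ m k
s-large m k e rewrite e = refl

s≡sumL-compatible′ : ∀ m k' → sumL (compatible m) (markings′ m k') ≡ s m k'
s≡sumL-compatible′ m k' with m <ᵇ 5 in e
... | false = trans (s≡sumL-compatible m k' (≮ᵇ⇒≤ e)) (s-large m k' e)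
... | true with (m ≡ᵇ 1) ∧ (k' ≡ᵇ 0) in e2
... | false = refl
... | true with ∧-elim {m ≡ᵇ 1} e2
... | a , _ with ≡ᵇ≡true⇒≡ {m} a
... | refl = refl

suffixWeight : List ℕ → List ℕ → ℕ
suffixWeight S' v = b2n (headMinᵇ v ∧ all (occ v) S')

IsoInvariant-suffixWeight : ∀ S' → IsoInvariant (suffixWeight S')
IsoInvariant-suffixWeight S' u v iso = cong b2n
  (cong₂ _∧_ (headMin-resp u v iso) (all-cong (λ s → occ-resp u v s iso) S'))

HeadMinOnly-suffixWeight : ∀ S' → HeadMinOnly (suffixWeight S')
HeadMinOnly-suffixWeight S' x v nall with all (x <ᵇ_) v in e
... | true = ⊥-elim (nall (all<ᵇ⇒All x v e))
... | false = refl

headMin-markings′ : ∀ m k' S' → S' ∈ markings′ m k' → ∀ τ → length τ ≡ m → all (occ τ) S' ≡ true → headMinᵇ τ ≡ true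
headMin-markings′ m k' S' mem τ len h with markings′⁻ m k' S' mem
... | inj₂ (5≤m , mV) = headMin-markings m k' S' τ 5≤m mV len h
... | inj₁ (refl , _ , refl) with τ
... | x ∷ [] = refl

compatible-prependRun : ∀ ℓ₀ mL S' → (∀ τ → length τ ≡ suc mL → all (occ τ) S' ≡ true → headMinᵇ τ ≡ true) →
  compatible (suc ((2 * suc ℓ₀ + 2) + mL)) (prependRun (suc ℓ₀) S') ≡
    ((suc (suc ℓ₀) + mL) C (suc (suc ℓ₀))) * compatible (suc mL) S'
compatible-prependRun ℓ₀ mL S' hm =
  begin
    sumL (λ π → b2n (all (occ π) (prependRun ℓ S'))) (Perm N)
  ≡⟨ sumL-congP {P = PermShape N} pt (Perm-shape N) ⟩
    sumL (glued p α (suffixWeight S')) (Perm N)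
  ≡⟨ gluing p mL α (suffixWeight S') lenα (Distinct-runPattern ℓ) (IsoInvariant-suffixWeight S') (HeadMinOnly-suffixWeight S') ⟩
    ((aboveLast α + mL) C aboveLast α) * sumL (suffixWeight S') (Perm (suc mL))
  ≡⟨ cong₂ (λ a b → ((a + mL) C a) * b) (aboveLast-runPattern ℓ)
       (sumL-congP {P = PermShape (suc mL)} (λ τ (lenτ , _) → sym (absorb τ lenτ)) (Perm-shape (suc mL))) ⟩
    ((suc ℓ + mL) C suc ℓ) * compatible (suc mL) S'
  ∎
  where
  open ≡-Reasoning
  ℓ = suc ℓ₀
  p = 2 * ℓ + 2
  N = suc (p + mL)
  α = runPattern ℓ
  lenα : length α ≡ suc p
  lenα = trans (length-runPattern ℓ) (runLength≡ ℓ)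
  -- a permutation of size m′+1 carrying S′ already has its head minimal
  absorb : ∀ v → length v ≡ suc mL → b2n (all (occ v) S') ≡ suffixWeight S' v
  absorb v len with all (occ v) S' in e
  ... | true rewrite hm v len e = refl
  ... | false with headMinᵇ v
  ... | true = refl
  ... | false = refl
  -- occurrences along the run are the prefix condition, those of the shifted
  -- S′ are occurrences in the suffix from position 2ℓ+2
  pt : ∀ π → PermShape N π → b2n (all (occ π) (prependRun ℓ S')) ≡ glued p α (suffixWeight S') π
  pt π (lenπ , _) =
    trans (cong b2n (trans (all-++ (occ π) (run ℓ) (map (p +_) S'))
                     (cong₂ _∧_ (trans (runOccurrences ℓ₀ π) (cong (λ z → isoᵇ (take z π) α) (runLength≡ ℓ))) (all-occ-shift p π S'))))
    (trans (b2n-∧ (isoᵇ (take (suc p) π) α) _)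
    (cong (b2n (isoᵇ (take (suc p) π) α) *_) (absorb (drop p π) lenD)))
    where
    lenD : length (drop p π) ≡ suc mL
    lenD = trans (length-drop p π) (trans (cong (_∸ p) lenπ) (trans (cong (_∸ p) (sym (+-suc p mL))) (m+n∸m≡n p (suc mL))))

sumL-compatible-prependRun′ : ∀ ℓ₀ mL k' →
  sumL (λ S' → compatible (suc ((2 * suc ℓ₀ + 2) + mL)) (prependRun (suc ℓ₀) S')) (markings′ (suc mL) k')
   ≡ ((suc ((2 * suc ℓ₀ + 2) + mL) ∸ suc ℓ₀ ∸ 2) C (suc ℓ₀ + 1)) * sumL (compatible (suc mL)) (markings′ (suc mL) k')
sumL-compatible-prependRun′ ℓ₀ mL k' =
  trans (sumL-cong-∈ (λ S' mS' → compatible-prependRun ℓ₀ mL S' (headMin-markings′ (suc mL) k' S' mS')))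
  (trans (sym (sumL-*ˡ ((suc (suc ℓ₀) + mL) C (suc (suc ℓ₀))) (compatible (suc mL)) (markings′ (suc mL) k')))
         (cong (_* sumL (compatible (suc mL)) (markings′ (suc mL) k')) (cong₂ _C_ (sym (suffix-length-arith (suc ℓ₀) mL)) (+-comm 1 (suc ℓ₀)))))

sumL-compatible-prependRun : ∀ n k ℓ → ℓ ∈ admissibleLengths n k →
  sumL (compatible n) (map (prependRun ℓ) (markings′ (n ∸ 2 * ℓ ∸ 2) (k ∸ ℓ))) ≡
    ((n ∸ ℓ ∸ 2) C (ℓ + 1)) * s (n ∸ 2 * ℓ ∸ 2) (k ∸ ℓ)
sumL-compatible-prependRun n k ℓ mℓ with ∈admissibleLengths⇒ n k ℓ mℓ
sumL-compatible-prependRun n k (suc ℓ₀) mℓ | _ , b , _ = trans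
  (sumL-map (compatible n) (prependRun ℓ) (markings′ m (k ∸ ℓ))) main
  where
  ℓ = suc ℓ₀
  p = 2 * ℓ + 2
  m = n ∸ 2 * ℓ ∸ 2
  le22 : p ≤ n
  le22 = 2ℓ+2≤n n ℓ b
  nE0 : n ≡ p + m
  nE0 = n≡2ℓ+2+rest n ℓ le22
  1≤m : 1 ≤ m
  1≤m = +-cancelˡ-≤ p 1 m (subst (p + 1 ≤_) nE0 (≤-trans (≤-reflexive (sym (2ℓ+3≡[2ℓ+2]+1 ℓ))) b))
  mL = pred m
  mE : m ≡ suc mL
  mE = sym (suc-pred-pos m 1≤m)
    where
    suc-pred-pos : ∀ m → 1 ≤ m → suc (pred m) ≡ m
    suc-pred-pos (suc m) _ = refl
  nE : n ≡ suc (p + mL)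
  nE = trans nE0 (trans (cong (p +_) mE) (+-suc p mL))
  main : sumL (λ S' → compatible n (prependRun ℓ S')) (markings′ m (k ∸ ℓ)) ≡ ((n ∸ ℓ ∸ 2) C (ℓ + 1)) * s m (k ∸ ℓ)
  main = subst₂ (λ n' m' → sumL (λ S' → compatible n' (prependRun ℓ S')) (markings′ m' (k ∸ ℓ)) ≡
    ((n' ∸ ℓ ∸ 2) C (ℓ + 1)) * s m' (k ∸ ℓ)) (sym nE) (sym mE)
           (trans (sumL-compatible-prependRun′ ℓ₀ mL (k ∸ ℓ)) (cong (((suc (p + mL) ∸ ℓ ∸ 2) C (ℓ + 1)) *_) (s≡sumL-compatible′ (suc mL) (k ∸ ℓ))))

rhs-as-sumL : ∀ n k → rhs n k ≡ sumL (λ ℓ → ((n ∸ ℓ ∸ 2) C (ℓ + 1)) * s (n ∸ 2 * ℓ ∸ 2) (k ∸ ℓ)) (admissibleLengths n k)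
rhs-as-sumL n k = sum-map (λ ℓ → ((n ∸ ℓ ∸ 2) C (ℓ + 1)) * s (n ∸ 2 * ℓ ∸ 2) (k ∸ ℓ)) (admissibleLengths n k)

theorem3p7 : (n k : ℕ) → 5 ≤ n → s n k ≡ rhs n k
theorem3p7 n k 5≤n =
  begin
    s n k
  ≡⟨ sym (s≡sumL-compatible n k 5≤n) ⟩
    sumL (compatible n) (markings n k)
  ≡⟨ sumL-markings≡runDecomposition n k (compatible n) 5≤n ⟩
    sumL (compatible n) (runDecomposition n k)
  ≡⟨ sumL-concatMap (compatible n) (withInitialRun n k) (admissibleLengths n k) ⟩
    sumL (λ ℓ → sumL (compatible n) (withInitialRun n k ℓ)) (admissibleLengths n k)
  ≡⟨ sumL-cong-∈ (sumL-compatible-prependRun n k) ⟩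
    sumL (λ ℓ → ((n ∸ ℓ ∸ 2) C (ℓ + 1)) * s (n ∸ 2 * ℓ ∸ 2) (k ∸ ℓ)) (admissibleLengths n k)
  ≡⟨ sym (rhs-as-sumL n k) ⟩
    rhs n k
  ∎
  where open ≡-Reasoning
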